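{- For all integers $n,k\geq 1$, \[op_{2,1}(n,k+1)=\overline{M}_k(n)/2\qquad\text{and}\qquad op_{2,1}(n,k)-op_{2,1}(n,k+1)=\overline{N}_k(n).\]
   Context: An overpartition of $n$ is a partition of $n$ in which the last occurrence of each part size may be overlined. For an overpartition $\pi$, $\overline{mex}_{2,1}(\pi)$ denotes the smallest positive odd integer that does not occur as a non-overlined part of $\pi$. For $n\geq 1$ and $k\geq 0$, $op_{2,1}(n,k)$ denotes the number of overpartitions $\pi$ of $n$ such that $\overline{mex}_{2,1}(\pi)\geq 2k+1$ and $\overline{mex}_{2,1}(\pi)\equiv 2k+1 \pmod 4$. Notation: $(a;q)_\infty=\prod_{i\geq 0}(1-aq^i)$, $(a;q)_n=(a;q)_\infty/(aq^n;q)_\infty$. $\overline{M}_k(n)$ is the number of overpartitions of $n$ in which the smallest part size larger than $k$ occurs at least $k+1$ times (counting overlined and non-overlined occurrences); equivalently, $\sum_{n\geq1}\overline{M}_k(n)q^n=2\frac{(-q;q)_k}{(q;q)_k}\sum_{j=0}^\infty\frac{q^{(k+1)(k+j+1)}(-q^{k+j+2};q)_\infty}{(q^{k+j+1};q)_\infty}$. $\overline{N}_k(n)$ (after Li) is the number of overpartitions of $n$ in which a part of size $k$ has to be overlined and the smallest part $>k-1$ appears exactly $k$ times and cannot be overlined; precisely, $\overline{N}_k(n)$ is the coefficient of $q^n$ in $\frac{(-q;q)_k}{(q;q)_{k-1}}\sum_{j=0}^\infty\frac{q^{k(k+j)}(-q^{k+j+1};q)_\infty}{(q^{k+j+1};q)_\infty}$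 (parts of sizes $<k$ form an arbitrary overpartition, at most one overlined part $k$ may be added, a non-overlined size $s=k+j\geq k$ occurs exactly $k$ times, and all other parts are larger than $s$). -}

module Defs where

open import Data.Nat using (ℕ; zero; suc; _+_; _*_; _∸_; _%_; _≤ᵇ_; _≡ᵇ_)
open import Data.Bool using (Bool; true; false; if_then_else_; _∧_; not)
open import Data.Product using (_×_; _,_; proj₁; proj₂)
open import Data.Maybe using (Maybe; just; nothing)
open import Data.List using (List; []; _∷_; [_]; map; concatMap; upTo)
open import Data.Bool.ListAction using (all)
open import Data.Vec using (Vec; []; _∷_)

-- An overpartition all of whose parts are ≤ m is encoded by its multiplicity
-- data: entry number i (0-based) of the vector describes part size i+1 as a pair
-- (number of NON-overlined parts of that size , whether an overlined part of that
-- size is present).  (Only the last occurrence of a size may be overlined, so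
-- at most one overlined copy per size.)  This encoding is a bijection with
-- overpartitions with parts ≤ m.
Mult : ℕ → Set
Mult m = Vec (ℕ × Bool) m

multAt : ∀ {m} → Mult m → ℕ → ℕ × Bool
multAt [] s = (0 , false)
multAt (x ∷ v) zero = (0 , false)
multAt (x ∷ v) (suc zero) = x
multAt (x ∷ v) (suc (suc s)) = multAt v (suc s)

nonOv : ∀ {m} → Mult m → ℕ → ℕ
nonOv v s = proj₁ (multAt v s)

ov : ∀ {m} → Mult m → ℕ → Bool
ov v s = proj₂ (multAt v s)

bit : Bool → ℕ
bit true = 1
bit false = 0

totalMult : ∀ {m} → Mult m → ℕ → ℕ
totalMult v s = nonOv v s + bit (ov v s)

weightFrom : ∀ {m} → ℕ → Mult m → ℕ
weightFrom s [] = 0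
weightFrom s ((c , b) ∷ v) = s * (c + bit b) + weightFrom (suc s) v

weight : ∀ {m} → Mult m → ℕ
weight = weightFrom 1

allMult : (m b : ℕ) → List (Mult m)
allMult zero b = [ [] ]
allMult (suc m) b =
  concatMap (λ c → concatMap (λ o → map ((c , o) ∷_) (allMult m b)) (true ∷ false ∷ []))
            (upTo (suc b))

-- the list of all overpartitions of n (each exactly once); parts are ≤ n
-- and each non-overlined count is ≤ n
overpartitions : (n : ℕ) → List (Mult n)
overpartitions n = Data.List.filterᵇ (λ v → weight v ≡ᵇ n) (allMult n n)
  where import Data.List

count : ∀ {A : Set} → (A → Bool) → List A → ℕ
count p [] = 0
count p (x ∷ xs) = if p x then suc (count p xs) else count p xs

numOP : (n : ℕ) → (Mult n → Bool) → ℕ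
numOP n p = count p (overpartitions n)

-- Search j = 1,3,5,... ; with fuel m+1 the search
-- reaches 2m+1 > m, where the count is certainly 0, so the fuel never runs out.
oddMexSearch : ∀ {m} → ℕ → ℕ → Mult m → ℕ
oddMexSearch zero j v = j
oddMexSearch (suc f) j v with nonOv v j
... | zero = j
... | suc _ = oddMexSearch f (suc (suc j)) v

mexbar21 : ∀ {m} → Mult m → ℕ
mexbar21 {m} v = oddMexSearch (suc m) 1 v

op21 : ℕ → ℕ → ℕ
op21 n k = numOP n (λ v → ((2 * k + 1) ≤ᵇ mexbar21 v)
                          ∧ ((mexbar21 v % 4) ≡ᵇ ((2 * k + 1) % 4)))

firstPos : (ℕ → ℕ) → ℕ → ℕ → Maybe ℕ
firstPos g zero s = nothing
firstPos g (suc f) s with g s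
... | zero = firstPos g f (suc s)
... | suc _ = just s

-- M̄_k(n): the smallest part size larger than k exists and occurs at least
-- k+1 times (overlined and non-overlined occurrences counted).
-- Parts are ≤ n, so searching n+1 sizes from k+1 suffices.
Mpred : ∀ {n} → ℕ → Mult n → Bool
Mpred {n} k v with firstPos (totalMult v) (suc n) (suc k)
... | nothing = false
... | just s = suc k ≤ᵇ totalMult v s

Mbar : ℕ → ℕ → ℕ
Mbar k n = numOP n (Mpred k)

-- N̄_k(n) (Li), read off from its generating function
--   (-q;q)_k/(q;q)_{k-1} Σ_j q^{k(k+j)} (-q^{k+j+1};q)_∞/(q^{k+j+1};q)_∞ :
-- parts < k arbitrary; letting s be the least size ≥ k having a non-overlined
-- part, s exists, exactly k non-overlined parts of size s occur, and no
-- overlined part has size in (k, s]  (an overlined k is allowed; non-overlined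
-- sizes in [k,s) are absent by minimality of s; sizes > s are arbitrary).
noOvIn : ∀ {n} → ℕ → ℕ → Mult n → Bool
noOvIn a b v = all (λ i → not (ov v (a + i))) (upTo (suc b ∸ a))

Npred : ∀ {n} → ℕ → Mult n → Bool
Npred {n} k v with firstPos (nonOv v) (suc n) k
... | nothing = false
... | just s = (nonOv v s ≡ᵇ k) ∧ noOvIn (suc k) s v

Nbar : ℕ → ℕ → ℕ
Nbar k n = numOP n (Npred k)

-- Write p̄(x) for the number of overpartitions of x. An overpartition has mex̄₂,₁ ≥ 2j+1 exactly
-- when 1, 3, …, 2j-1 occur as non-overlined parts, and every odd number ≥ 2j+1 is ≡ 2j+1 or
-- 2j+3 (mod 4); removing one non-overlined copy of each of these parts gives
--   op₂,₁(n,j) + op₂,₁(n,j+1) = p̄(n - j²).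
-- Identities between the generating functions ∏ (1+q^a)/(1-q^a) of overpartitions into the
-- sizes a, a+1, …, proved by adding one size at a time, give
--   2 p̄(n - (k+1)²) = M̄_k(n) + M̄_{k+1}(n)   and   p̄(n - k²) = M̄_k(n) + N̄_k(n).
-- All these counts vanish once k ≥ n, so the first identity telescopes to
-- 2 op₂,₁(n,k+1) = M̄_k(n), and the second then gives op₂,₁(n,k) - op₂,₁(n,k+1) = N̄_k(n).
module Submission where

open import Data.Bool using (Bool; true; false; if_then_else_; _∧_; not; T)
open import Data.Bool.Properties using (T-≡; if-eta; ∧-zeroʳ; ∧-identityʳ; not-involutive)
open import Data.Bool.ListAction using (all)
open import Data.Empty using (⊥-elim)
open import Data.List using (List; []; _∷_; _++_; map; concatMap; applyUpTo; upTo; filterᵇ)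
open import Data.Maybe using (Maybe; just; nothing)
open import Data.Nat using (ℕ; zero; suc; _+_; _*_; _∸_; _≤_; _<_; _≤ᵇ_; _≡ᵇ_; _%_; z≤n; s≤s; _≤?_)
open import Data.Nat.DivMod using ([m+n]%n≡m%n)
open import Data.Nat.Properties
open import Data.Nat.Tactic.RingSolver using (solve-∀)
open import Data.Product using (_×_; _,_)
open import Data.Unit using (tt)
open import Data.Vec using ([]; _∷_)
open import Function.Bundles using (Equivalence)
open import Relation.Nullary using (yes; no)
open import Relation.Binary.PropositionalEquality
open import Algebra.Properties.CommutativeSemigroup +-commutativeSemigroup using (interchange)
open import Defs

open ≡-Reasoning

T-ext : ∀ {b c} → (T b → T c) → (T c → T b) → b ≡ c
T-ext {true} {true} _ _ = refl
T-ext {true} {false} f _ = ⊥-elim (f tt)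
T-ext {false} {true} _ g = ⊥-elim (g tt)
T-ext {false} {false} _ _ = refl

≤⇒≤ᵇ≡true : ∀ {m n} → m ≤ n → (m ≤ᵇ n) ≡ true
≤⇒≤ᵇ≡true p = Equivalence.to T-≡ (≤⇒≤ᵇ p)

>⇒≤ᵇ≡false : ∀ {m n} → n < m → (m ≤ᵇ n) ≡ false
>⇒≤ᵇ≡false {m} {n} p = T-ext (λ t → <⇒≱ p (≤ᵇ⇒≤ m n t)) λ ()

≤ᵇ-suc : ∀ m n → (suc m ≤ᵇ suc n) ≡ (m ≤ᵇ n)
≤ᵇ-suc zero n = refl
≤ᵇ-suc (suc m) n = refl

step-range : ∀ a m {x} → x < a + suc m → x < suc a + m
step-range a m {x} = subst (x <_) (+-suc a m)

step-fits : ∀ a m {N} → a + suc m ≤ N → suc a + m ≤ N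
step-fits a m {N} = subst (_≤ N) (+-suc a m)

-- Formal power series with coefficients in ℕ, as coefficient sequences:
-- shift a f = q^a f,  Γ a f = f / (1 - q^a),  Ω a f = f (1 + q^a) / (1 - q^a).

Series : Set
Series = ℕ → ℕ

0# : Series
0# _ = 0

infixl 6 _⊕_
_⊕_ : Series → Series → Series
(f ⊕ g) x = f x + g x

_≈[_]_ : Series → ℕ → Series → Set
f ≈[ N ] g = ∀ x → x < N → f x ≡ g x

shift : ℕ → Series → Series
shift a g x = if a ≤ᵇ x then g (x ∸ a) else 0

shift-≤ : ∀ a g x → a ≤ x → shift a g x ≡ g (x ∸ a)
shift-≤ a g x p rewrite ≤⇒≤ᵇ≡true p = refl

shift-< : ∀ a g x → x < a → shift a g x ≡ 0
shift-< a g x p rewrite >⇒≤ᵇ≡false {a} {x} p = refl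

shift-0# : ∀ a x → shift a 0# x ≡ 0
shift-0# a x = if-eta (a ≤ᵇ x)

shift-*0 : ∀ a g x → shift (a * 0) g x ≡ g x
shift-*0 a g x rewrite *-zeroʳ a = refl

shift-exponent : ∀ {a b} g x → a ≡ b → shift a g x ≡ shift b g x
shift-exponent g x refl = refl

shift-⊕ : ∀ a f g x → shift a (f ⊕ g) x ≡ shift a f x + shift a g x
shift-⊕ a f g x with a ≤? x
... | yes p rewrite shift-≤ a (f ⊕ g) x p | shift-≤ a f x p | shift-≤ a g x p = refl
... | no p rewrite shift-< a (f ⊕ g) x (≰⇒> p) | shift-< a f x (≰⇒> p) | shift-< a g x (≰⇒> p) = refl

shift-cong≈ : ∀ a N f g → f ≈[ N ] g → shift a f ≈[ N ] shift a g
shift-cong≈ a N f g e x x<N with a ≤? x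
... | yes p rewrite shift-≤ a f x p | shift-≤ a g x p = e (x ∸ a) (≤-<-trans (m∸n≤m x a) x<N)
... | no p rewrite shift-< a f x (≰⇒> p) | shift-< a g x (≰⇒> p) = refl

shift-cong : ∀ a f g → (∀ x → f x ≡ g x) → ∀ x → shift a f x ≡ shift a g x
shift-cong a f g e x = shift-cong≈ a (suc x) f g (λ y _ → e y) x ≤-refl

shift-cong-below : ∀ a' n f g y → (∀ z → z ≤ n → f z ≡ g z) → y ≤ suc n →
  shift (suc a') f y ≡ shift (suc a') g y
shift-cong-below a' n f g y e y≤1+n with suc a' ≤? y
... | yes p rewrite shift-≤ (suc a') f y p | shift-≤ (suc a') g y p =
  e (y ∸ suc a') (≤-trans (∸-monoʳ-≤ y (s≤s (z≤n {a'}))) (∸-monoˡ-≤ 1 y≤1+n))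
... | no p rewrite shift-< (suc a') f y (≰⇒> p) | shift-< (suc a') g y (≰⇒> p) = refl

shift-shift : ∀ a b g x → shift a (shift b g) x ≡ shift (a + b) g x
shift-shift a b g x with a ≤? x
... | no p rewrite shift-< a (shift b g) x (≰⇒> p)
                 | shift-< (a + b) g x (<-≤-trans (≰⇒> p) (m≤m+n a b)) = refl
... | yes p with b ≤? (x ∸ a)
...   | yes q rewrite shift-≤ a (shift b g) x p | shift-≤ b g (x ∸ a) q
                    | shift-≤ (a + b) g x (subst (a + b ≤_) (m+[n∸m]≡n p) (+-monoʳ-≤ a q))
                    | ∸-+-assoc x a b = refl
...   | no q rewrite shift-≤ a (shift b g) x p | shift-< b g (x ∸ a) (≰⇒> q)
                   | shift-< (a + b) g x (subst (_< a + b) (m+[n∸m]≡n p) (+-monoʳ-< a (≰⇒> q))) = refl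

shift-comm : ∀ a b g x → shift a (shift b g) x ≡ shift b (shift a g) x
shift-comm a b g x = begin
  shift a (shift b g) x  ≡⟨ shift-shift a b g x ⟩
  shift (a + b) g x      ≡⟨ shift-exponent g x (+-comm a b) ⟩
  shift (b + a) g x      ≡⟨ shift-shift b a g x ⟨
  shift b (shift a g) x  ∎

shift-shift-*suc : ∀ a t g x → shift a (shift (a * t) g) x ≡ shift (a * suc t) g x
shift-shift-*suc a t g x = trans (shift-shift a (a * t) g x) (shift-exponent g x (sym (*-suc a t)))

shift-beyond : ∀ a' t' g x → x < suc a' + 0 → shift (suc a' * suc t') g x ≡ 0
shift-beyond a' t' g x x< =
  shift-< _ g x (<-≤-trans (subst (x <_) (+-identityʳ (suc a')) x<) (m≤m*n (suc a') (suc t')))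

-- Γ a h = h + q^a (Γ a h), unrolled with fuel x at degree x; the fuel suffices when a ≥ 1
-- (Γ 0 is junk and never used).
Γ-fuel : ℕ → Series → ℕ → Series
Γ-fuel a h zero x = h x
Γ-fuel a h (suc f) x = h x + (if a ≤ᵇ x then Γ-fuel a h f (x ∸ a) else 0)

Γ : ℕ → Series → Series
Γ a h x = Γ-fuel a h x x

∸-suc-mono : ∀ a' {x k} → x ≤ suc k → x ∸ suc a' ≤ k
∸-suc-mono a' {x} x≤1+k = ≤-trans (∸-monoʳ-≤ x (s≤s (z≤n {a'}))) (∸-monoˡ-≤ 1 x≤1+k)

Γ-fuel-irrelevant : ∀ a' h f g x → x ≤ f → x ≤ g → Γ-fuel (suc a') h f x ≡ Γ-fuel (suc a') h g x
Γ-fuel-irrelevant a' h zero zero x p q = refl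
Γ-fuel-irrelevant a' h zero (suc g) zero p q = sym (+-identityʳ (h zero))
Γ-fuel-irrelevant a' h (suc f) zero zero p q = +-identityʳ (h zero)
Γ-fuel-irrelevant a' h (suc f) (suc g) x p q with suc a' ≤? x
... | yes r rewrite ≤⇒≤ᵇ≡true r =
  cong (h x +_) (Γ-fuel-irrelevant a' h f g (x ∸ suc a') (∸-suc-mono a' p) (∸-suc-mono a' q))
... | no r rewrite >⇒≤ᵇ≡false {suc a'} {x} (≰⇒> r) = refl

Γ-unfold : ∀ a' h x → Γ (suc a') h x ≡ h x + shift (suc a') (Γ (suc a') h) x
Γ-unfold a' h zero = sym (+-identityʳ (h zero))
Γ-unfold a' h (suc x) with suc a' ≤? suc x
... | yes r rewrite ≤⇒≤ᵇ≡true r =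
  cong (h (suc x) +_) (Γ-fuel-irrelevant a' h x (x ∸ a') (x ∸ a') (m∸n≤m x a') ≤-refl)
... | no r rewrite >⇒≤ᵇ≡false {suc a'} {suc x} (≰⇒> r) = refl

-- Since a ≥ 1, F = h + q^a F determines F coefficient by coefficient.
Γ-unique : ∀ a' h F N → (∀ x → x < N → F x ≡ h x + shift (suc a') F x) → F ≈[ N ] Γ (suc a') h
Γ-unique a' h F N F-eq x x<N = go x x ≤-refl x<N
  where
    go : ∀ f x → x ≤ f → x < N → F x ≡ Γ-fuel (suc a') h f x
    go zero .zero z≤n q = trans (F-eq 0 q) (+-identityʳ (h 0))
    go (suc f) x p q with suc a' ≤? x
    ... | yes r rewrite ≤⇒≤ᵇ≡true r = begin
      F x                                       ≡⟨ F-eq x q ⟩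
      h x + shift (suc a') F x                  ≡⟨ cong (h x +_) (shift-≤ (suc a') F x r) ⟩
      h x + F (x ∸ suc a')                      ≡⟨ cong (h x +_) (go f (x ∸ suc a') (∸-suc-mono a' p)
                                                     (≤-<-trans (m∸n≤m x (suc a')) q)) ⟩
      h x + Γ-fuel (suc a') h f (x ∸ suc a')    ∎
    ... | no r rewrite >⇒≤ᵇ≡false {suc a'} {x} (≰⇒> r) =
      trans (F-eq x q) (cong (h x +_) (shift-< (suc a') F x (≰⇒> r)))

Γ-cong≈ : ∀ a' N f g → f ≈[ N ] g → Γ (suc a') f ≈[ N ] Γ (suc a') g
Γ-cong≈ a' N f g e = Γ-unique a' g (Γ (suc a') f) N
  (λ x q → trans (Γ-unfold a' f x) (cong (_+ shift (suc a') (Γ (suc a') f) x) (e x q)))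

Γ-cong : ∀ a' f g → (∀ x → f x ≡ g x) → ∀ x → Γ (suc a') f x ≡ Γ (suc a') g x
Γ-cong a' f g e x = Γ-cong≈ a' (suc x) f g (λ y _ → e y) x ≤-refl

Γ-⊕ : ∀ a' f g x → Γ (suc a') (f ⊕ g) x ≡ Γ (suc a') f x + Γ (suc a') g x
Γ-⊕ a' f g x = sym (Γ-unique a' (f ⊕ g) (Γ a f ⊕ Γ a g) (suc x) unfold x ≤-refl)
  where
    a = suc a'
    unfold : ∀ y → y < suc x → Γ a f y + Γ a g y ≡ (f y + g y) + shift a (Γ a f ⊕ Γ a g) y
    unfold y _ rewrite Γ-unfold a' f y | Γ-unfold a' g y | shift-⊕ a (Γ a f) (Γ a g) y =
      interchange (f y) (shift a (Γ a f) y) (g y) (shift a (Γ a g) y)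

Γ-shift : ∀ b' a h x → Γ (suc b') (shift a h) x ≡ shift a (Γ (suc b') h) x
Γ-shift b' a h x = sym (Γ-unique b' (shift a h) (shift a (Γ b h)) (suc x) unfold x ≤-refl)
  where
    b = suc b'
    unfold : ∀ y → y < suc x → shift a (Γ b h) y ≡ shift a h y + shift b (shift a (Γ b h)) y
    unfold y _ = begin
      shift a (Γ b h) y                                ≡⟨ shift-cong a _ _ (Γ-unfold b' h) y ⟩
      shift a (h ⊕ shift b (Γ b h)) y                  ≡⟨ shift-⊕ a h (shift b (Γ b h)) y ⟩
      shift a h y + shift a (shift b (Γ b h)) y        ≡⟨ cong (shift a h y +_) (shift-comm a b (Γ b h) y) ⟩
      shift a h y + shift b (shift a (Γ b h)) y        ∎

Γ-0# : ∀ a' x → Γ (suc a') 0# x ≡ 0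
Γ-0# a' x = sym (Γ-unique a' 0# 0# (suc x) (λ y _ → sym (shift-0# (suc a') y)) x ≤-refl)

Γ-vanishing : ∀ a' N f → f ≈[ N ] 0# → Γ (suc a') f ≈[ N ] 0#
Γ-vanishing a' N f e x q = trans (Γ-cong≈ a' N f 0# e x q) (Γ-0# a' x)

Ω : ℕ → Series → Series
Ω a h = Γ a h ⊕ shift a (Γ a h)

Ω-cong≈ : ∀ a' N f g → f ≈[ N ] g → Ω (suc a') f ≈[ N ] Ω (suc a') g
Ω-cong≈ a' N f g e x q =
  cong₂ _+_ (Γ-cong≈ a' N f g e x q) (shift-cong≈ (suc a') N _ _ (Γ-cong≈ a' N f g e) x q)

Ω-vanishing : ∀ a' N f → f ≈[ N ] 0# → Ω (suc a') f ≈[ N ] 0#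
Ω-vanishing a' N f e x q = trans (Ω-cong≈ a' N f 0# e x q)
  (cong₂ _+_ (Γ-0# a' x) (trans (shift-cong (suc a') _ 0# (Γ-0# a') x) (shift-0# (suc a') x)))

Ω-⊕ : ∀ a' f g x → Ω (suc a') (f ⊕ g) x ≡ Ω (suc a') f x + Ω (suc a') g x
Ω-⊕ a' f g x = trans (cong₂ _+_ (Γ-⊕ a' f g x)
    (trans (shift-cong a (Γ a (f ⊕ g)) (Γ a f ⊕ Γ a g) (Γ-⊕ a' f g) x) (shift-⊕ a (Γ a f) (Γ a g) x)))
    (interchange (Γ a f x) (Γ a g x) (shift a (Γ a f) x) (shift a (Γ a g) x))
  where a = suc a'

Ω-shift : ∀ a' d h x → Ω (suc a') (shift d h) x ≡ shift d (Ω (suc a') h) x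
Ω-shift a' d h x = begin
  Γ a (shift d h) x + shift a (Γ a (shift d h)) x
    ≡⟨ cong₂ _+_ (Γ-shift a' d h x) (shift-cong a _ _ (Γ-shift a' d h) x) ⟩
  shift d (Γ a h) x + shift a (shift d (Γ a h)) x
    ≡⟨ cong (shift d (Γ a h) x +_) (shift-comm a d (Γ a h) x) ⟩
  shift d (Γ a h) x + shift d (shift a (Γ a h)) x
    ≡⟨ shift-⊕ d (Γ a h) (shift a (Γ a h)) x ⟨
  shift d (Ω a h) x ∎
  where a = suc a'

shift-⊕-shift : ∀ e f d g x → shift e (f ⊕ shift d g) x ≡ shift e f x + shift (e + d) g x
shift-⊕-shift e f d g x = trans (shift-⊕ e f (shift d g) x) (cong (shift e f x +_) (shift-shift e d g x))

Γ-Ω : ∀ t' a' h y →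
  Γ (suc t') (Ω (suc a') h) y ≡ (Γ (suc t') (Γ (suc a') h) ⊕ shift (suc a') (Γ (suc t') (Γ (suc a') h))) y
Γ-Ω t' a' h y = trans (Γ-⊕ t' (Γ (suc a') h) _ y) (cong (Γ (suc t') (Γ (suc a') h) y +_) (Γ-shift t' (suc a') _ y))

Γ-Γ-unfold : ∀ t' a' h y →
  Γ (suc t') (Γ (suc a') h) y ≡ (Γ (suc t') h ⊕ shift (suc a') (Γ (suc t') (Γ (suc a') h))) y
Γ-Γ-unfold t' a' h y = begin
  Γ t (Γ a h) y                              ≡⟨ Γ-cong t' _ _ (Γ-unfold a' h) y ⟩
  Γ t (h ⊕ shift a (Γ a h)) y                ≡⟨ Γ-⊕ t' h _ y ⟩
  Γ t h y + Γ t (shift a (Γ a h)) y          ≡⟨ cong (Γ t h y +_) (Γ-shift t' a (Γ a h) y) ⟩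
  Γ t h y + shift a (Γ t (Γ a h)) y          ∎
  where
    a = suc a'
    t = suc t'

Ω-shift-Γ : ∀ t' d V x → Ω (suc t') (shift d V) x ≡ shift d (Γ (suc t') V) x + shift (d + suc t') (Γ (suc t') V) x
Ω-shift-Γ t' d V x = trans (Ω-shift t' d V x) (shift-⊕-shift d (Γ (suc t') V) (suc t') (Γ (suc t') V) x)

-- As rational functions of u = q^a and v = q^t:
-- (1+u)/((1-u)(1-v)) = v/(1-v) + 1/(1-u) + u(1+v)/((1-u)(1-v)).
shift-Γ-Ω-split : ∀ t' a' T x →
  shift (suc a' * suc t') (Γ (suc t') (Ω (suc a') T)) x ≡
    shift (suc (suc a') * suc t') (Γ (suc t') T) x + shift (suc a' * suc t') (Γ (suc a') T) x
    + Ω (suc t') (shift (suc a' * suc (suc t')) (Γ (suc a') T)) x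
shift-Γ-Ω-split t' a' T x = begin
  shift (a * t) (Γ t (Ω a T)) x
    ≡⟨ trans (shift-cong (a * t) _ _ (Γ-Ω t' a' T) x) (shift-⊕-shift (a * t) U a U x) ⟩
  shift (a * t) U x + shift (a * t + a) U x
    ≡⟨ cong (_+ shift (a * t + a) U x)
         (trans (shift-cong (a * t) _ _ (Γ-unfold t' V) x) (shift-⊕-shift (a * t) V t U x)) ⟩
  shift (a * t) V x + shift (a * t + t) U x + shift (a * t + a) U x
    ≡⟨ cong (λ z → shift (a * t) V x + z + shift (a * t + a) U x)
         (trans (shift-cong (a * t + t) _ _ (Γ-Γ-unfold t' a' T) x) (shift-⊕-shift (a * t + t) W a U x)) ⟩
  shift (a * t) V x + (shift (a * t + t) W x + shift (a * t + t + a) U x) + shift (a * t + a) U x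
    ≡⟨ cong₂ (λ e₁ e₂ → shift (a * t) V x + (shift e₁ W x + shift e₂ U x) + shift (a * t + a) U x)
         (+-comm (a * t) t) (exponent a t) ⟩
  shift (a * t) V x + (shift (suc a * t) W x + shift (a * suc t + t) U x) + shift (a * t + a) U x
    ≡⟨ cong (λ e → shift (a * t) V x + (shift (suc a * t) W x + shift (a * suc t + t) U x) + shift e U x)
         (trans (+-comm (a * t) a) (sym (*-suc a t))) ⟩
  shift (a * t) V x + (shift (suc a * t) W x + shift (a * suc t + t) U x) + shift (a * suc t) U x
    ≡⟨ rearrange (shift (a * t) V x) (shift (suc a * t) W x) (shift (a * suc t + t) U x) (shift (a * suc t) U x) ⟩
  shift (suc a * t) W x + shift (a * t) V x + (shift (a * suc t) U x + shift (a * suc t + t) U x)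
    ≡⟨ cong (shift (suc a * t) W x + shift (a * t) V x +_) (Ω-shift-Γ t' (a * suc t) V x) ⟨
  shift (suc a * t) W x + shift (a * t) V x + Ω t (shift (a * suc t) V) x ∎
  where
    a = suc a'
    t = suc t'
    V = Γ a T
    U = Γ t V
    W = Γ t T
    exponent : ∀ a t → a * t + t + a ≡ a * suc t + t
    exponent = solve-∀
    rearrange : ∀ p q r s → p + (q + r) + s ≡ q + p + (s + r)
    rearrange = solve-∀

-- As rational functions of u = q^a and v = q^k:
-- (1+u)/((1-u)(1-v)) = v/(1-v) + 2u/((1-u)(1-v)) + 1.
Γ-shift-Ω-split : ∀ k' a' T x →
  Γ (suc k') (shift (suc a' * suc k') (Ω (suc a') T)) x ≡
    Γ (suc k') (shift (suc (suc a') * suc k') T) x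
    + (Γ (suc k') (shift (suc a' * suc (suc k')) (Γ (suc a') T)) x
       + Γ (suc k') (shift (suc a' * suc (suc k')) (Γ (suc a') T)) x)
    + shift (suc a' * suc k') T x
Γ-shift-Ω-split k' a' T x = begin
  Γ k (shift (a * k) (Ω a T)) x
    ≡⟨ Γ-shift k' (a * k) (Ω a T) x ⟩
  shift (a * k) (Γ k (Ω a T)) x
    ≡⟨ trans (shift-cong (a * k) _ _ (Γ-Ω k' a' T) x) (shift-⊕-shift (a * k) U a U x) ⟩
  shift (a * k) U x + shift (a * k + a) U x
    ≡⟨ cong (_+ shift (a * k + a) U x)
         (trans (shift-cong (a * k) _ _ (Γ-Γ-unfold k' a' T) x) (shift-⊕-shift (a * k) W a U x)) ⟩
  shift (a * k) W x + shift (a * k + a) U x + shift (a * k + a) U x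
    ≡⟨ cong (λ z → z + shift (a * k + a) U x + shift (a * k + a) U x)
         (trans (shift-cong (a * k) _ _ (Γ-unfold k' T) x) (shift-⊕-shift (a * k) T k W x)) ⟩
  shift (a * k) T x + shift (a * k + k) W x + shift (a * k + a) U x + shift (a * k + a) U x
    ≡⟨ cong₂ (λ e₁ e₂ → shift (a * k) T x + shift e₁ W x + shift e₂ U x + shift e₂ U x)
         (+-comm (a * k) k) (trans (+-comm (a * k) a) (sym (*-suc a k))) ⟩
  shift (a * k) T x + shift (suc a * k) W x + shift (a * suc k) U x + shift (a * suc k) U x
    ≡⟨ rearrange (shift (a * k) T x) (shift (suc a * k) W x) (shift (a * suc k) U x) ⟩
  shift (suc a * k) W x + (shift (a * suc k) U x + shift (a * suc k) U x) + shift (a * k) T x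
    ≡⟨ cong₂ (λ p q → p + (q + q) + shift (a * k) T x) (Γ-shift k' (suc a * k) T x) (Γ-shift k' (a * suc k) V x) ⟨
  Γ k (shift (suc a * k) T) x + (Γ k (shift (a * suc k) V) x + Γ k (shift (a * suc k) V) x) + shift (a * k) T x ∎
  where
    a = suc a'
    k = suc k'
    V = Γ a T
    U = Γ k V
    W = Γ k T
    rearrange : ∀ p q r → p + q + r + r ≡ q + (r + r) + p
    rearrange = solve-∀

module _ {A : Set} where
  count-++ : ∀ (p : A → Bool) xs ys → count p (xs ++ ys) ≡ count p xs + count p ys
  count-++ p [] ys = refl
  count-++ p (x ∷ xs) ys with p x
  ... | true = cong suc (count-++ p xs ys)
  ... | false = count-++ p xs ys

  count-cong : ∀ (p q : A → Bool) → (∀ x → p x ≡ q x) → ∀ xs → count p xs ≡ count q xs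
  count-cong p q e [] = refl
  count-cong p q e (x ∷ xs) rewrite e x with q x
  ... | true = cong suc (count-cong p q e xs)
  ... | false = count-cong p q e xs

  count-none : ∀ (p : A → Bool) → (∀ x → p x ≡ false) → ∀ xs → count p xs ≡ 0
  count-none p e [] = refl
  count-none p e (x ∷ xs) rewrite e x = count-none p e xs

  count-add : ∀ (p q r : A → Bool) → (∀ x → bit (p x) + bit (q x) ≡ bit (r x)) →
    ∀ xs → count p xs + count q xs ≡ count r xs
  count-add p q r e [] = refl
  count-add p q r e (x ∷ xs) with p x | q x | r x | e x
  ... | true | true | true | ()
  ... | true | true | false | ()
  ... | true | false | true | _ = cong suc (count-add p q r e xs)
  ... | true | false | false | ()
  ... | false | true | true | _ = trans (+-suc (count p xs) (count q xs)) (cong suc (count-add p q r e xs))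
  ... | false | true | false | ()
  ... | false | false | true | ()
  ... | false | false | false | _ = count-add p q r e xs

count-map : ∀ {A B : Set} (p : B → Bool) (g : A → B) xs → count p (map g xs) ≡ count (λ x → p (g x)) xs
count-map p g [] = refl
count-map p g (x ∷ xs) with p (g x)
... | true = cong suc (count-map p g xs)
... | false = count-map p g xs

count-filter : ∀ {A : Set} (p q : A → Bool) xs → count p (filterᵇ q xs) ≡ count (λ x → q x ∧ p x) xs
count-filter p q [] = refl
count-filter p q (x ∷ xs) with q x
... | false = count-filter p q xs
... | true with p x
...   | true = cong suc (count-filter p q xs)
...   | false = count-filter p q xs

Σ< : ℕ → (ℕ → ℕ) → ℕ
Σ< zero φ = 0
Σ< (suc n) φ = φ 0 + Σ< n (λ c → φ (suc c))

Σ<-cong : ∀ n φ ψ → (∀ c → φ c ≡ ψ c) → Σ< n φ ≡ Σ< n ψ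
Σ<-cong zero φ ψ e = refl
Σ<-cong (suc n) φ ψ e = cong₂ _+_ (e 0) (Σ<-cong n _ _ (λ c → e (suc c)))

Σ<-0 : ∀ n φ → (∀ c → φ c ≡ 0) → Σ< n φ ≡ 0
Σ<-0 zero φ e = refl
Σ<-0 (suc n) φ e rewrite e 0 = Σ<-0 n _ (λ c → e (suc c))

Σ<-⊕ : ∀ n φ ψ → Σ< n (λ c → φ c + ψ c) ≡ Σ< n φ + Σ< n ψ
Σ<-⊕ zero φ ψ = refl
Σ<-⊕ (suc n) φ ψ rewrite Σ<-⊕ n (λ c → φ (suc c)) (λ c → ψ (suc c)) = interchange (φ 0) (ψ 0) _ _

count-concat : ∀ {A B : Set} (p : B → Bool) n (f : A → List B) (g : ℕ → A) →
  count p (concatMap f (applyUpTo g n)) ≡ Σ< n (λ c → count p (f (g c)))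
count-concat p zero f g = refl
count-concat p (suc n) f g =
  trans (count-++ p (f (g 0)) _) (cong (count p (f (g 0)) +_) (count-concat p n f (λ c → g (suc c))))

+≡ᵇ-split : ∀ u y x → ((u + y) ≡ᵇ x) ≡ (if u ≤ᵇ x then (y ≡ᵇ (x ∸ u)) else false)
+≡ᵇ-split u y x with u ≤? x
... | yes p rewrite ≤⇒≤ᵇ≡true p = T-ext
   (λ t → ≡⇒≡ᵇ y (x ∸ u) (trans (sym (m+n∸m≡n u y)) (cong (_∸ u) (≡ᵇ⇒≡ (u + y) x t))))
   (λ t → ≡⇒≡ᵇ (u + y) x (trans (cong (u +_) (≡ᵇ⇒≡ y (x ∸ u) t)) (m+[n∸m]≡n p)))
... | no p rewrite >⇒≤ᵇ≡false {u} {x} (≰⇒> p) = T-ext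
   (λ t → ⊥-elim (p (subst (u ≤_) (≡ᵇ⇒≡ (u + y) x t) (m≤m+n u y)))) (λ ())

+≤ᵇ-split : ∀ a b x → a ≤ x → (a + b ≤ᵇ x) ≡ (b ≤ᵇ (x ∸ a))
+≤ᵇ-split a b x p = T-ext
  (λ t → ≤⇒≤ᵇ (m+n≤o⇒m≤o∸n b (subst (_≤ x) (+-comm a b) (≤ᵇ⇒≤ (a + b) x t))))
  (λ t → ≤⇒≤ᵇ (subst (_≤ x) (+-comm b a) (m≤o∸n⇒m+n≤o b p (≤ᵇ⇒≤ b (x ∸ a) t))))

count-if-∧ : ∀ {A : Set} (W : List A) (b : Bool) (q r : A → Bool) →
  count (λ w → (if b then q w else false) ∧ r w) W ≡ (if b then count (λ w → q w ∧ r w) W else 0)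
count-if-∧ W true q r = refl
count-if-∧ W false q r = count-none _ (λ _ → refl) W

Σq : ℕ → ℕ → (ℕ → Series) → Series
Σq n a φ y = Σ< (suc n) (λ c → if a * c ≤ᵇ y then φ c (y ∸ a * c) else 0)

Σq-shift : ∀ n a (ψ : ℕ → Series) x →
  Σ< (suc n) (λ c → if a * suc c ≤ᵇ x then ψ c (x ∸ a * suc c) else 0) ≡ shift a (Σq n a ψ) x
Σq-shift n a ψ x with a ≤? x
... | yes a≤x = trans (Σ<-cong (suc n) _ _ term) (sym (shift-≤ a (Σq n a ψ) x a≤x))
  where
    term : ∀ c → (if a * suc c ≤ᵇ x then ψ c (x ∸ a * suc c) else 0)
               ≡ (if a * c ≤ᵇ x ∸ a then ψ c (x ∸ a ∸ a * c) else 0)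
    term c rewrite *-suc a c | +≤ᵇ-split a (a * c) x a≤x | ∸-+-assoc x a (a * c) = refl
... | no a≰x = trans (Σ<-0 (suc n) _ term) (sym (shift-< a (Σq n a ψ) x (≰⇒> a≰x)))
  where
    term : ∀ c → (if a * suc c ≤ᵇ x then ψ c (x ∸ a * suc c) else 0) ≡ 0
    term c rewrite *-suc a c | >⇒≤ᵇ≡false {a + a * c} {x} (<-≤-trans (≰⇒> a≰x) (m≤m+n a (a * c))) = refl

Σq-term0 : ∀ a (φ : ℕ → Series) y → (if a * 0 ≤ᵇ y then φ 0 (y ∸ a * 0) else 0) ≡ φ 0 y
Σq-term0 a φ y rewrite *-zeroʳ a = refl

Σq-peel : ∀ n a φ y → Σq (suc n) a φ y ≡ φ 0 y + shift a (Σq n a (λ c → φ (suc c))) y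
Σq-peel n a φ y = cong₂ _+_ (Σq-term0 a φ y) (Σq-shift n a (λ c → φ (suc c)) y)

Σq-base : ∀ a φ y → Σq 0 a φ y ≡ φ 0 y
Σq-base a φ y = trans (+-identityʳ _) (Σq-term0 a φ y)

Σq-cong : ∀ n a φ ψ → (∀ c z → φ c z ≡ ψ c z) → ∀ y → Σq n a φ y ≡ Σq n a ψ y
Σq-cong n a φ ψ e y = Σ<-cong (suc n) _ _ (λ c → cong (λ b → if a * c ≤ᵇ y then b else 0) (e c (y ∸ a * c)))

Σq-⊕ : ∀ n a φ ψ y → Σq n a (λ c → φ c ⊕ ψ c) y ≡ Σq n a φ y + Σq n a ψ y
Σq-⊕ n a φ ψ y = trans (Σ<-cong (suc n) _ _ term)
  (Σ<-⊕ (suc n) (λ c → if a * c ≤ᵇ y then φ c (y ∸ a * c) else 0)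
                (λ c → if a * c ≤ᵇ y then ψ c (y ∸ a * c) else 0))
  where
    term : ∀ c → (if a * c ≤ᵇ y then φ c (y ∸ a * c) + ψ c (y ∸ a * c) else 0) ≡
                 (if a * c ≤ᵇ y then φ c (y ∸ a * c) else 0) + (if a * c ≤ᵇ y then ψ c (y ∸ a * c) else 0)
    term c with a * c ≤ᵇ y
    ... | true = refl
    ... | false = refl

Σq-0# : ∀ n a y → Σq n a (λ _ → 0#) y ≡ 0
Σq-0# n a y = Σ<-0 (suc n) _ (λ c → if-eta (a * c ≤ᵇ y))

Σq-const : ∀ n a' h y → y ≤ n → Σq n (suc a') (λ _ → h) y ≡ Γ (suc a') h y
Σq-const zero a' h .zero z≤n = Σq-base (suc a') (λ _ → h) zero
Σq-const (suc n) a' h y y≤1+n = begin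
  Σq (suc n) a (λ _ → h) y
    ≡⟨ Σq-peel n a (λ _ → h) y ⟩
  h y + shift a (Σq n a (λ _ → h)) y
    ≡⟨ cong (h y +_) (shift-cong-below a' n _ (Γ a h) y (Σq-const n a' h) y≤1+n) ⟩
  h y + shift a (Γ a h) y
    ≡⟨ Γ-unfold a' h y ⟨
  Γ a h y ∎
  where a = suc a'

from : ℕ → Series → ℕ → Series
from t h c = if t ≤ᵇ c then h else 0#

at : ℕ → Series → ℕ → Series
at t h c = if c ≡ᵇ t then h else 0#

Σq-from : ∀ t n a' h y → y ≤ n → Σq n (suc a') (from t h) y ≡ shift (suc a' * t) (Γ (suc a') h) y
Σq-from zero n a' h y y≤n = trans (Σq-const n a' h y y≤n) (sym (shift-*0 (suc a') (Γ (suc a') h) y))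
Σq-from (suc t) zero a' h .zero z≤n = Σq-base (suc a') (from (suc t) h) zero
Σq-from (suc t) (suc n) a' h y y≤1+n = begin
  Σq (suc n) a (from (suc t) h) y
    ≡⟨ Σq-peel n a (from (suc t) h) y ⟩
  0 + shift a (Σq n a (λ c → from (suc t) h (suc c))) y
    ≡⟨ shift-cong-below a' n _ (shift (a * t) (Γ a h)) y
         (λ z z≤n → trans (Σq-cong n a _ (from t h) (λ c w → cong (λ b → (if b then h else 0#) w) (≤ᵇ-suc t c)) z)
                          (Σq-from t n a' h z z≤n)) y≤1+n ⟩
  shift a (shift (a * t) (Γ a h)) y
    ≡⟨ shift-shift-*suc a t (Γ a h) y ⟩
  shift (a * suc t) (Γ a h) y ∎
  where a = suc a'

Σq-at : ∀ t n a' h y → y ≤ n → Σq n (suc a') (at t h) y ≡ shift (suc a' * t) h y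
Σq-at zero zero a' h .zero z≤n = trans (Σq-base (suc a') (at zero h) zero) (sym (shift-*0 (suc a') h zero))
Σq-at zero (suc n) a' h y y≤1+n = begin
  Σq (suc n) a (at zero h) y              ≡⟨ Σq-peel n a (at zero h) y ⟩
  h y + shift a (Σq n a (λ _ → 0#)) y     ≡⟨ cong (h y +_) (trans (shift-cong a _ 0# (Σq-0# n a) y) (shift-0# a y)) ⟩
  h y + 0                                 ≡⟨ +-identityʳ (h y) ⟩
  h y                                     ≡⟨ shift-*0 a h y ⟨
  shift (a * 0) h y                       ∎
  where a = suc a'
Σq-at (suc t) zero a' h .zero z≤n = Σq-base (suc a') (at (suc t) h) zero
Σq-at (suc t) (suc n) a' h y y≤1+n = begin
  Σq (suc n) a (at (suc t) h) y           ≡⟨ Σq-peel n a (at (suc t) h) y ⟩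
  0 + shift a (Σq n a (at t h)) y         ≡⟨ shift-cong-below a' n _ (shift (a * t) h) y (Σq-at t n a' h) y≤1+n ⟩
  shift a (shift (a * t) h) y             ≡⟨ shift-shift-*suc a t h y ⟩
  shift (a * suc t) h y                   ∎
  where a = suc a'

Σq-at0 : ∀ n a' h y → y ≤ n → Σq n (suc a') (at 0 h) y ≡ h y
Σq-at0 n a' h y y≤n = trans (Σq-at 0 n a' h y y≤n) (shift-*0 (suc a') h y)

minMult≥ : ℕ → ∀ {m} → Mult m → Bool
minMult≥ u [] = false
minMult≥ u ((c , o) ∷ w) = if (c + bit o) ≡ᵇ 0 then minMult≥ u w else (u ≤ᵇ (c + bit o))

firstPlain≡ : ℕ → ∀ {m} → Mult m → Bool
firstPlain≡ k [] = false
firstPlain≡ k ((c , o) ∷ w) = if c ≡ᵇ 0 then (not o ∧ firstPlain≡ k w) else ((c ≡ᵇ k) ∧ not o)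

firstPlain≡⁺ : ℕ → ∀ {m} → Mult m → Bool
firstPlain≡⁺ k [] = false
firstPlain≡⁺ k ((c , o) ∷ w) = if c ≡ᵇ 0 then firstPlain≡ k w else (c ≡ᵇ k)

skip : ℕ → (∀ {m} → Mult m → Bool) → ∀ {m} → Mult m → Bool
skip zero Q v = Q v
skip (suc p) Q [] = false
skip (suc p) Q (e ∷ w) = skip p Q w

hasOdds : ℕ → ∀ {m} → Mult m → Bool
hasOdds′ : ℕ → ∀ {m} → Mult m → Bool
hasOdds zero v = true
hasOdds (suc j) [] = false
hasOdds (suc j) ((c , o) ∷ w) = (1 ≤ᵇ c) ∧ hasOdds′ j w
hasOdds′ zero v = true
hasOdds′ (suc j) [] = false
hasOdds′ (suc j) (e ∷ w) = hasOdds (suc j) w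

skip-suc : ∀ {m} p (Q : ∀ {m} → Mult m → Bool) (v : Mult m) → skip (suc p) Q v ≡ skip p (skip 1 Q) v
skip-suc zero Q v = refl
skip-suc (suc p) Q [] = refl
skip-suc (suc p) Q (e ∷ w) = skip-suc p Q w

skip-beyond : ∀ {m} p (Q : ∀ {m} → Mult m → Bool) (v : Mult m) → Q [] ≡ false → m ≤ p → skip p Q v ≡ false
skip-beyond zero Q [] Q[]≡false _ = Q[]≡false
skip-beyond (suc p) Q [] _ _ = refl
skip-beyond (suc p) Q (e ∷ w) Q[]≡false (s≤s m≤p) = skip-beyond p Q w Q[]≡false m≤p

firstPos-zero : ∀ (g : ℕ → ℕ) f s → (∀ t → g t ≡ 0) → firstPos g f s ≡ nothing
firstPos-zero g zero s g≡0 = refl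
firstPos-zero g (suc f) s g≡0 with g s | g≡0 s
... | zero | _ = firstPos-zero g f (suc s) g≡0

total≥At : ∀ {m} → ℕ → Mult m → Maybe ℕ → Bool
total≥At r v nothing = false
total≥At r v (just t) = r ≤ᵇ totalMult v t

firstTotal≥ : ∀ {m} → ℕ → ℕ → ℕ → Mult m → Bool
firstTotal≥ f s r v = total≥At r v (firstPos (totalMult v) f s)

Mpred≡firstTotal≥ : ∀ {n} k (v : Mult n) → Mpred k v ≡ firstTotal≥ (suc n) (suc k) (suc k) v
Mpred≡firstTotal≥ {n} k v with firstPos (totalMult v) (suc n) (suc k)
... | nothing = refl
... | just s = refl

firstTotal≥-∷ : ∀ {m} f s r e (w : Mult m) → firstTotal≥ f (suc (suc s)) r (e ∷ w) ≡ firstTotal≥ f (suc s) r w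
firstTotal≥-∷ zero s r e w = refl
firstTotal≥-∷ (suc f) s r e w with totalMult w (suc s)
... | zero = firstTotal≥-∷ f (suc s) r e w
... | suc _ = refl

firstTotal≥-[] : ∀ f s r → firstTotal≥ f s r [] ≡ false
firstTotal≥-[] f s r = cong (total≥At r []) (firstPos-zero (totalMult []) f s (λ _ → refl))

firstTotal≥≡minMult≥ : ∀ {m} r (v : Mult m) f → m ≤ f → firstTotal≥ f 1 r v ≡ minMult≥ r v
firstTotal≥≡minMult≥ r [] f _ = firstTotal≥-[] f 1 r
firstTotal≥≡minMult≥ r ((c , o) ∷ w) (suc f) (s≤s m≤f) with c + bit o in eq
... | zero = trans (firstTotal≥-∷ f 0 r (c , o) w) (firstTotal≥≡minMult≥ r w f m≤f)
... | suc _ = cong (r ≤ᵇ_) eq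

firstTotal≥≡skip : ∀ {m} r p (v : Mult m) f → m ≤ f → firstTotal≥ f (suc p) r v ≡ skip p (minMult≥ r) v
firstTotal≥≡skip r zero v f m≤f = firstTotal≥≡minMult≥ r v f m≤f
firstTotal≥≡skip r (suc p) [] f _ = firstTotal≥-[] f (suc (suc p)) r
firstTotal≥≡skip r (suc p) (e ∷ w) f m≤f =
  trans (firstTotal≥-∷ f p r e w) (firstTotal≥≡skip r p w f (≤-trans (n≤1+n _) m≤f))

Mpred≡skip-minMult≥ : ∀ {n} k (v : Mult n) → Mpred k v ≡ skip k (minMult≥ (suc k)) v
Mpred≡skip-minMult≥ {n} k v = trans (Mpred≡firstTotal≥ k v) (firstTotal≥≡skip (suc k) k v (suc n) (n≤1+n n))

plainExactlyAt : ∀ {m} → ℕ → ℕ → Mult m → Maybe ℕ → Bool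
plainExactlyAt k lo v nothing = false
plainExactlyAt k lo v (just t) = (nonOv v t ≡ᵇ k) ∧ noOvIn lo t v

firstPlainExactly : ∀ {m} → ℕ → ℕ → ℕ → ℕ → Mult m → Bool
firstPlainExactly f s k lo v = plainExactlyAt k lo v (firstPos (nonOv v) f s)

Npred≡firstPlainExactly : ∀ {n} k (v : Mult n) → Npred k v ≡ firstPlainExactly (suc n) k k (suc k) v
Npred≡firstPlainExactly {n} k v with firstPos (nonOv v) (suc n) k
... | nothing = refl
... | just s = refl

firstPlainExactly-∷ : ∀ {m} f s k lo e (w : Mult m) →
  firstPlainExactly f (suc (suc s)) k (suc (suc lo)) (e ∷ w) ≡ firstPlainExactly f (suc s) k (suc lo) w
firstPlainExactly-∷ zero s k lo e w = refl
firstPlainExactly-∷ (suc f) s k lo e w with nonOv w (suc s)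
... | zero = firstPlainExactly-∷ f (suc s) k lo e w
... | suc _ = refl

firstPlainExactly-[] : ∀ f s k lo → firstPlainExactly f s k lo [] ≡ false
firstPlainExactly-[] f s k lo = cong (plainExactlyAt k lo []) (firstPos-zero (nonOv []) f s (λ _ → refl))

all-applyUpTo-cong : ∀ n (p q : ℕ → Bool) (g h : ℕ → ℕ) → (∀ i → p (g i) ≡ q (h i)) →
  all p (applyUpTo g n) ≡ all q (applyUpTo h n)
all-applyUpTo-cong zero p q g h e = refl
all-applyUpTo-cong (suc n) p q g h e =
  cong₂ _∧_ (e 0) (all-applyUpTo-cong n p q (λ i → g (suc i)) (λ i → h (suc i)) (λ i → e (suc i)))

∧-swap : ∀ x y z → (x ∧ (y ∧ z)) ≡ (y ∧ (x ∧ z))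
∧-swap true y z = refl
∧-swap false y z = sym (∧-zeroʳ y)

firstPlainExactly-noOv₁ : ∀ {m} f s k (v : Mult m) →
  firstPlainExactly f (suc s) k 1 v ≡ not (ov v 1) ∧ firstPlainExactly f (suc s) k 2 v
firstPlainExactly-noOv₁ zero s k v = sym (∧-zeroʳ _)
firstPlainExactly-noOv₁ (suc f) s k v with nonOv v (suc s)
... | zero = firstPlainExactly-noOv₁ f (suc s) k v
... | suc c = trans
  (cong (λ b → (nonOv v (suc s) ≡ᵇ k) ∧ (not (ov v 1) ∧ b))
        (all-applyUpTo-cong s (λ i → not (ov v (1 + i))) (λ i → not (ov v (2 + i))) suc (λ i → i) (λ i → refl)))
  (∧-swap (nonOv v (suc s) ≡ᵇ k) (not (ov v 1)) _)

firstPlainExactly≡firstPlain≡ : ∀ {m} k (w : Mult m) f → m ≤ f → firstPlainExactly f 1 k 1 w ≡ firstPlain≡ k w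
firstPlainExactly≡firstPlain≡ k [] f _ = firstPlainExactly-[] f 1 k 1
firstPlainExactly≡firstPlain≡ k ((zero , o) ∷ w) (suc f) (s≤s m≤f) =
  trans (firstPlainExactly-noOv₁ f 1 k ((zero , o) ∷ w))
        (cong (not o ∧_) (trans (firstPlainExactly-∷ f 0 k 0 (zero , o) w) (firstPlainExactly≡firstPlain≡ k w f m≤f)))
firstPlainExactly≡firstPlain≡ k ((suc c , o) ∷ w) (suc f) (s≤s _) = cong ((suc c ≡ᵇ k) ∧_) (∧-identityʳ (not o))

firstPlainExactly≡firstPlain≡⁺ : ∀ {m} k (v : Mult m) f → m ≤ f →
  firstPlainExactly f 1 k 2 v ≡ firstPlain≡⁺ k v
firstPlainExactly≡firstPlain≡⁺ k [] f _ = firstPlainExactly-[] f 1 k 2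
firstPlainExactly≡firstPlain≡⁺ k ((zero , o) ∷ w) (suc f) (s≤s m≤f) =
  trans (firstPlainExactly-∷ f 0 k 0 (zero , o) w) (firstPlainExactly≡firstPlain≡ k w f m≤f)
firstPlainExactly≡firstPlain≡⁺ k ((suc c , o) ∷ w) (suc f) (s≤s _) = ∧-identityʳ _

firstPlainExactly≡skip : ∀ {m} k p (v : Mult m) f → m ≤ f →
  firstPlainExactly f (suc p) k (suc (suc p)) v ≡ skip p (firstPlain≡⁺ k) v
firstPlainExactly≡skip k zero v f m≤f = firstPlainExactly≡firstPlain≡⁺ k v f m≤f
firstPlainExactly≡skip k (suc p) [] f _ = firstPlainExactly-[] f (suc (suc p)) k (suc (suc (suc p)))
firstPlainExactly≡skip k (suc p) (e ∷ w) f m≤f =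
  trans (firstPlainExactly-∷ f p k (suc p) e w) (firstPlainExactly≡skip k p w f (≤-trans (n≤1+n _) m≤f))

Npred≡skip-firstPlain≡⁺ : ∀ {n} k' (v : Mult n) → Npred (suc k') v ≡ skip k' (firstPlain≡⁺ (suc k')) v
Npred≡skip-firstPlain≡⁺ {n} k' v =
  trans (Npred≡firstPlainExactly (suc k') v) (firstPlainExactly≡skip (suc k') k' v (suc n) (n≤1+n n))

oddMexIndex : ∀ {m} → Mult m → ℕ
oddMexIndex′ : ∀ {m} → Mult m → ℕ
oddMexIndex [] = 0
oddMexIndex ((c , o) ∷ w) = if c ≡ᵇ 0 then 0 else oddMexIndex′ w
oddMexIndex′ [] = 1
oddMexIndex′ (e ∷ w) = suc (oddMexIndex w)

hasOdds≡≤ᵇoddMexIndex : ∀ {m} j (v : Mult m) → hasOdds j v ≡ (j ≤ᵇ oddMexIndex v)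
hasOdds′≡≤ᵇoddMexIndex′ : ∀ {m} j (w : Mult m) → hasOdds′ j w ≡ (suc j ≤ᵇ oddMexIndex′ w)
hasOdds≡≤ᵇoddMexIndex zero v = refl
hasOdds≡≤ᵇoddMexIndex (suc j) [] = refl
hasOdds≡≤ᵇoddMexIndex (suc j) ((zero , o) ∷ w) = refl
hasOdds≡≤ᵇoddMexIndex (suc j) ((suc c , o) ∷ w) = hasOdds′≡≤ᵇoddMexIndex′ j w
hasOdds′≡≤ᵇoddMexIndex′ zero [] = refl
hasOdds′≡≤ᵇoddMexIndex′ zero (e ∷ w) = refl
hasOdds′≡≤ᵇoddMexIndex′ (suc j) [] = refl
hasOdds′≡≤ᵇoddMexIndex′ (suc j) (e ∷ w) =
  trans (hasOdds≡≤ᵇoddMexIndex (suc j) w) (sym (≤ᵇ-suc (suc j) (oddMexIndex w)))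

oddMexSearch-∷∷ : ∀ {m} f j e₁ e₂ (w : Mult m) →
  oddMexSearch f (suc (suc (suc j))) (e₁ ∷ e₂ ∷ w) ≡ 2 + oddMexSearch f (suc j) w
oddMexSearch-∷∷ zero j e₁ e₂ w = refl
oddMexSearch-∷∷ (suc f) j e₁ e₂ w with nonOv w (suc j)
... | zero = refl
... | suc _ = oddMexSearch-∷∷ f (suc (suc j)) e₁ e₂ w

oddMexSearch≡ : ∀ {m} (v : Mult m) f → m ≤ f → oddMexSearch (suc f) 1 v ≡ 2 * oddMexIndex v + 1
oddMexSearch≡ [] f _ = refl
oddMexSearch≡ ((zero , o) ∷ w) f _ = refl
oddMexSearch≡ ((suc c , o) ∷ []) (suc f) _ = refl
oddMexSearch≡ ((suc c , o) ∷ e₂ ∷ w) (suc (suc f)) (s≤s (s≤s m≤f)) = begin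
  oddMexSearch (suc (suc (suc f))) 1 ((suc c , o) ∷ e₂ ∷ w)
    ≡⟨ oddMexSearch-∷∷ (suc (suc f)) 0 (suc c , o) e₂ w ⟩
  2 + oddMexSearch (suc (suc f)) 1 w
    ≡⟨ cong (2 +_) (oddMexSearch≡ w (suc f) (≤-trans m≤f (n≤1+n f))) ⟩
  2 + (2 * oddMexIndex w + 1)
    ≡⟨ 2+[2x+1]≡2[1+x]+1 (oddMexIndex w) ⟩
  2 * suc (oddMexIndex w) + 1 ∎
  where
    2+[2x+1]≡2[1+x]+1 : ∀ x → 2 + (2 * x + 1) ≡ 2 * suc x + 1
    2+[2x+1]≡2[1+x]+1 = solve-∀

mexbar21≡2*oddMexIndex+1 : ∀ {n} (v : Mult n) → mexbar21 v ≡ 2 * oddMexIndex v + 1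
mexbar21≡2*oddMexIndex+1 {n} v = oddMexSearch≡ v n ≤-refl

isEven : ℕ → Bool
isEven zero = true
isEven (suc n) = not (isEven n)

oddMod4 : ℕ → ℕ
oddMod4 u = if isEven u then 1 else 3

[2u+1]%4≡oddMod4 : ∀ u → (2 * u + 1) % 4 ≡ oddMod4 u
[2u+1]%4≡oddMod4 zero = refl
[2u+1]%4≡oddMod4 (suc zero) = refl
[2u+1]%4≡oddMod4 (suc (suc u)) = begin
  (2 * suc (suc u) + 1) % 4    ≡⟨ cong (_% 4) (2[2+u]+1≡[2u+1]+4 u) ⟩
  (2 * u + 1 + 4) % 4          ≡⟨ [m+n]%n≡m%n (2 * u + 1) 4 ⟩
  (2 * u + 1) % 4              ≡⟨ [2u+1]%4≡oddMod4 u ⟩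
  oddMod4 u                    ≡⟨ cong (λ b → if b then 1 else 3) (not-involutive (isEven u)) ⟨
  oddMod4 (suc (suc u))        ∎
  where
    2[2+u]+1≡[2u+1]+4 : ∀ u → 2 * suc (suc u) + 1 ≡ (2 * u + 1) + 4
    2[2+u]+1≡[2u+1]+4 = solve-∀

2j+1≤ᵇ2u+1 : ∀ j u → (2 * j + 1 ≤ᵇ 2 * u + 1) ≡ (j ≤ᵇ u)
2j+1≤ᵇ2u+1 j u = T-ext
  (λ t → ≤⇒≤ᵇ {j} {u} (*-cancelˡ-≤ 2 (+-cancelʳ-≤ 1 (2 * j) (2 * u) (≤ᵇ⇒≤ _ _ t))))
  (λ t → ≤⇒≤ᵇ (+-monoˡ-≤ 1 (*-monoʳ-≤ 2 {j} {u} (≤ᵇ⇒≤ j u t))))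

oddMod4-not≡ᵇ : ∀ a b →
  ((if not a then 1 else 3) ≡ᵇ (if not b then 1 else 3)) ≡ ((if a then 1 else 3) ≡ᵇ (if b then 1 else 3))
oddMod4-not≡ᵇ true true = refl
oddMod4-not≡ᵇ true false = refl
oddMod4-not≡ᵇ false true = refl
oddMod4-not≡ᵇ false false = refl

-- For j ≤ u, u lies in exactly one of the classes of j and j + 1 modulo 2.
oddMod4-consecutive : ∀ j u →
  bit ((j ≤ᵇ u) ∧ (oddMod4 u ≡ᵇ oddMod4 j)) + bit ((suc j ≤ᵇ u) ∧ (oddMod4 u ≡ᵇ oddMod4 (suc j)))
  ≡ bit (j ≤ᵇ u)
oddMod4-consecutive zero zero = refl
oddMod4-consecutive zero (suc u) with isEven u
... | true = refl
... | false = refl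
oddMod4-consecutive (suc j) zero = refl
oddMod4-consecutive (suc j) (suc u) rewrite ≤ᵇ-suc j u | ≤ᵇ-suc (suc j) u
  | oddMod4-not≡ᵇ (isEven u) (isEven j) | oddMod4-not≡ᵇ (isEven u) (not (isEven j)) = oddMod4-consecutive j u

op21Pred : ℕ → ∀ {n} → Mult n → Bool
op21Pred k v = ((2 * k + 1) ≤ᵇ mexbar21 v) ∧ ((mexbar21 v % 4) ≡ᵇ ((2 * k + 1) % 4))

op21Pred-oddMexIndex : ∀ {n} k (v : Mult n) →
  op21Pred k v ≡ ((k ≤ᵇ oddMexIndex v) ∧ (oddMod4 (oddMexIndex v) ≡ᵇ oddMod4 k))
op21Pred-oddMexIndex k v
  rewrite mexbar21≡2*oddMexIndex+1 v | 2j+1≤ᵇ2u+1 k (oddMexIndex v)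
        | [2u+1]%4≡oddMod4 (oddMexIndex v) | [2u+1]%4≡oddMod4 k = refl

op21Pred-consecutive : ∀ {n} j (v : Mult n) → bit (op21Pred j v) + bit (op21Pred (suc j) v) ≡ bit (hasOdds j v)
op21Pred-consecutive j v rewrite op21Pred-oddMexIndex j v | op21Pred-oddMexIndex (suc j) v | hasOdds≡≤ᵇoddMexIndex j v =
  oddMod4-consecutive j (oddMexIndex v)

oddSum : ℕ → ℕ → ℕ
oddSum zero a = 0
oddSum (suc j) a = a + oddSum j (suc (suc a))

oddSum-suc : ∀ j a → oddSum j (suc a) ≡ j + oddSum j a
oddSum-suc zero a = refl
oddSum-suc (suc j) a rewrite oddSum-suc j (suc (suc a)) = regroup a j (oddSum j (suc (suc a)))
  where
    regroup : ∀ a j e → suc a + (j + e) ≡ suc j + (a + e)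
    regroup = solve-∀

oddSum-squares : ∀ j → oddSum j 1 ≡ j * j
oddSum-squares zero = refl
oddSum-squares (suc j) rewrite oddSum-suc j 2 | oddSum-suc j 1 | oddSum-squares j = square-suc j
  where
    square-suc : ∀ j → 1 + (j + (j + j * j)) ≡ suc j * suc j
    square-suc = solve-∀

-- Non-overlined multiplicities are capped at B (as in allMult), so #OP agrees with the true
-- counting series only in degrees ≤ B, and every identity below is stated in that range.
module Bounded (B : ℕ) where

  -- #OP m a P x counts the overpartitions of x into parts of sizes a, …, a + m - 1 satisfying P.
  #OP : (m a : ℕ) → (Mult m → Bool) → Series
  #OP m a P x = count (λ w → (weightFrom a w ≡ᵇ x) ∧ P w) (allMult m B)

  pbar : ℕ → ℕ → Series
  pbar m a = #OP m a (λ _ → true)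

  #OP-with-first : ∀ m a (P : Mult (suc m) → Bool) → Bool → ℕ → Series
  #OP-with-first m a P o c = #OP m (suc a) (λ w → P ((c , o) ∷ w))

  #OP-split : ∀ m a P x →
    #OP (suc m) a P x ≡ shift a (Σq B a (#OP-with-first m a P true)) x + Σq B a (#OP-with-first m a P false) x
  #OP-split m a P x = begin
    count counted (concatMap withFirst (upTo (suc B)))   ≡⟨ count-concat counted (suc B) withFirst (λ c → c) ⟩
    Σ< (suc B) (λ c → count counted (withFirst c))       ≡⟨ Σ<-cong (suc B) _ _ count-withFirst ⟩
    Σ< (suc B) (λ c → term true c + term false c)        ≡⟨ Σ<-⊕ (suc B) (term true) (term false) ⟩
    Σ< (suc B) (term true) + Σ< (suc B) (term false)
      ≡⟨ cong₂ _+_ (trans (Σ<-cong (suc B) _ _ term-overlined) (Σq-shift B a (#OP-with-first m a P true) x))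
                   (Σ<-cong (suc B) _ _ term-plain) ⟩
    shift a (Σq B a (#OP-with-first m a P true)) x + Σq B a (#OP-with-first m a P false) x ∎
    where
      tails = allMult m B
      counted : Mult (suc m) → Bool
      counted w = (weightFrom a w ≡ᵇ x) ∧ P w
      withFirst : ℕ → List (Mult (suc m))
      withFirst c = concatMap (λ o → map ((c , o) ∷_) tails) (true ∷ false ∷ [])
      term : Bool → ℕ → ℕ
      term o c = if a * (c + bit o) ≤ᵇ x then #OP-with-first m a P o c (x ∸ a * (c + bit o)) else 0
      count-first : ∀ o c → count (λ w → counted ((c , o) ∷ w)) tails ≡ term o c
      count-first o c = trans
        (count-cong _ _ (λ w → cong (_∧ P ((c , o) ∷ w)) (+≡ᵇ-split (a * (c + bit o)) (weightFrom (suc a) w) x)) tails)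
        (count-if-∧ tails (a * (c + bit o) ≤ᵇ x) _ _)
      count-withFirst : ∀ c → count counted (withFirst c) ≡ term true c + term false c
      count-withFirst c = begin
        count counted (map ((c , true) ∷_) tails ++ map ((c , false) ∷_) tails ++ [])
          ≡⟨ count-++ counted (map ((c , true) ∷_) tails) _ ⟩
        count counted (map ((c , true) ∷_) tails) + count counted (map ((c , false) ∷_) tails ++ [])
          ≡⟨ cong₂ _+_ (count-map counted _ tails)
                       (trans (count-++ counted (map ((c , false) ∷_) tails) []) (+-identityʳ _)) ⟩
        count (λ w → counted ((c , true) ∷ w)) tails + count counted (map ((c , false) ∷_) tails)
          ≡⟨ cong₂ _+_ (count-first true c) (trans (count-map counted _ tails) (count-first false c)) ⟩
        term true c + term false c ∎
      term-overlined : ∀ c → term true c ≡ (if a * suc c ≤ᵇ x then #OP-with-first m a P true c (x ∸ a * suc c) else 0)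
      term-overlined c rewrite +-comm c 1 = refl
      term-plain : ∀ c → term false c ≡ (if a * c ≤ᵇ x then #OP-with-first m a P false c (x ∸ a * c) else 0)
      term-plain c rewrite +-identityʳ c = refl

  #OP-cong : ∀ m a (P Q : Mult m → Bool) → (∀ w → P w ≡ Q w) → ∀ x → #OP m a P x ≡ #OP m a Q x
  #OP-cong m a P Q e x = count-cong _ _ (λ w → cong ((weightFrom a w ≡ᵇ x) ∧_) (e w)) (allMult m B)

  #OP-constant : ∀ m a (P : Mult m → Bool) b → (∀ w → P w ≡ b) →
    ∀ y → #OP m a P y ≡ (if b then pbar m a else 0#) y
  #OP-constant m a P true e y = #OP-cong m a P _ e y
  #OP-constant m a P false e y =
    count-none _ (λ w → trans (cong ((weightFrom a w ≡ᵇ y) ∧_) (e w)) (∧-zeroʳ _)) (allMult m B)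

  #OP-empty : ∀ a (P : Mult 0 → Bool) → P [] ≡ false → ∀ x → #OP 0 a P x ≡ 0
  #OP-empty a P e x = #OP-constant 0 a P false (λ { [] → e }) x

  #OP-by-first : ∀ m a P (ψ₁ ψ₀ : ℕ → Series) →
    (∀ c y → #OP-with-first m a P true c y ≡ ψ₁ c y) → (∀ c y → #OP-with-first m a P false c y ≡ ψ₀ c y) →
    ∀ x → #OP (suc m) a P x ≡ shift a (Σq B a ψ₁) x + Σq B a ψ₀ x
  #OP-by-first m a P ψ₁ ψ₀ e₁ e₀ x = trans (#OP-split m a P x)
    (cong₂ _+_ (shift-cong a _ _ (Σq-cong B a _ _ e₁) x) (Σq-cong B a _ _ e₀ x))

  #OP-ignoring-first : ∀ m a' (P : Mult (suc m) → Bool) (Q : Mult m → Bool) → (∀ e w → P (e ∷ w) ≡ Q w) →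
    ∀ x → x ≤ B → #OP (suc m) (suc a') P x ≡ Ω (suc a') (#OP m (suc (suc a')) Q) x
  #OP-ignoring-first m a' P Q P≡Q x x≤B = begin
    #OP (suc m) a P x
      ≡⟨ #OP-by-first m a P (λ _ → h) (λ _ → h) (λ c y → #OP-cong m (suc a) _ _ (P≡Q (c , true)) y)
                                                (λ c y → #OP-cong m (suc a) _ _ (P≡Q (c , false)) y) x ⟩
    shift a (Σq B a (λ _ → h)) x + Σq B a (λ _ → h) x
      ≡⟨ cong₂ _+_ (shift-cong-below a' B _ (Γ a h) x (Σq-const B a' h) (≤-trans x≤B (n≤1+n B)))
                   (Σq-const B a' h x x≤B) ⟩
    shift a (Γ a h) x + Γ a h x
      ≡⟨ +-comm (shift a (Γ a h) x) (Γ a h x) ⟩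
    Ω a h x ∎
    where
      a = suc a'
      h = #OP m (suc a) Q

  pbar-unfold≈ : ∀ m a' → pbar (suc m) (suc a') ≈[ suc B ] Ω (suc a') (pbar m (suc (suc a')))
  pbar-unfold≈ m a' x x<1+B = #OP-ignoring-first m a' (λ _ → true) (λ _ → true) (λ _ _ → refl) x (≤-pred x<1+B)

  shift-Σq-cong : ∀ a' ψ g x → (∀ z → z ≤ B → Σq B (suc a') ψ z ≡ g z) → x ≤ B →
    shift (suc a') (Σq B (suc a') ψ) x ≡ shift (suc a') g x
  shift-Σq-cong a' ψ g x e x≤B = shift-cong-below a' B _ g x e (≤-trans x≤B (n≤1+n B))

  #OP-minMult≥ : ∀ m a' u' x → x ≤ B →
    #OP (suc m) (suc a') (minMult≥ (suc u')) x ≡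
      #OP m (suc (suc a')) (minMult≥ (suc u')) x
      + (shift (suc a' * suc u') (Γ (suc a') (pbar m (suc (suc a')))) x
         + shift (suc a' * suc u') (Γ (suc a') (pbar m (suc (suc a')))) x)
  #OP-minMult≥ m a' u' x x≤B = begin
    #OP (suc m) a (minMult≥ u) x
      ≡⟨ #OP-by-first m a (minMult≥ u) (from u' pb) (λ c → at 0 H c ⊕ from u pb c) overlined plain x ⟩
    shift a (Σq B a (from u' pb)) x + Σq B a (λ c → at 0 H c ⊕ from u pb c) x
      ≡⟨ cong₂ _+_ (trans (shift-Σq-cong a' (from u' pb) (shift (a * u') (Γ a pb)) x (Σq-from u' B a' pb) x≤B)
                          (shift-shift-*suc a u' (Γ a pb) x))
                   (trans (Σq-⊕ B a (at 0 H) (from u pb) x)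
                          (cong₂ _+_ (Σq-at0 B a' H x x≤B) (Σq-from u B a' pb x x≤B))) ⟩
    X + (H x + X)
      ≡⟨ x+[y+x]≡y+[x+x] X (H x) ⟩
    H x + (X + X) ∎
    where
      a = suc a'
      u = suc u'
      pb = pbar m (suc a)
      H = #OP m (suc a) (minMult≥ u)
      X = shift (a * u) (Γ a pb) x
      x+[y+x]≡y+[x+x] : ∀ x y → x + (y + x) ≡ y + (x + x)
      x+[y+x]≡y+[x+x] = solve-∀
      overlined : ∀ c y → #OP-with-first m a (minMult≥ u) true c y ≡ from u' pb c y
      overlined c y = #OP-constant m (suc a) _ (u' ≤ᵇ c) (overlined-pred c) y
        where
          overlined-pred : ∀ c w → minMult≥ u ((c , true) ∷ w) ≡ (u' ≤ᵇ c)
          overlined-pred c w rewrite +-comm c 1 = ≤ᵇ-suc u' c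
      plain : ∀ c y → #OP-with-first m a (minMult≥ u) false c y ≡ (at 0 H c ⊕ from u pb c) y
      plain zero y = sym (+-identityʳ (H y))
      plain (suc c) y = #OP-constant m (suc a) _ (u ≤ᵇ suc c) (λ w → cong (λ z → u ≤ᵇ suc z) (+-identityʳ c)) y

  #OP-firstPlain≡ : ∀ m a' k' x → x ≤ B →
    #OP (suc m) (suc a') (firstPlain≡ (suc k')) x ≡
      #OP m (suc (suc a')) (firstPlain≡ (suc k')) x + shift (suc a' * suc k') (pbar m (suc (suc a'))) x
  #OP-firstPlain≡ m a' k' x x≤B = begin
    #OP (suc m) a (firstPlain≡ k) x
      ≡⟨ #OP-by-first m a (firstPlain≡ k) (λ _ → 0#) (λ c → at 0 N c ⊕ at k pb c) overlined plain x ⟩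
    shift a (Σq B a (λ _ → 0#)) x + Σq B a (λ c → at 0 N c ⊕ at k pb c) x
      ≡⟨ cong₂ _+_ (trans (shift-cong a _ 0# (Σq-0# B a) x) (shift-0# a x))
                   (trans (Σq-⊕ B a (at 0 N) (at k pb) x)
                          (cong₂ _+_ (Σq-at0 B a' N x x≤B) (Σq-at k B a' pb x x≤B))) ⟩
    N x + shift (a * k) pb x ∎
    where
      a = suc a'
      k = suc k'
      pb = pbar m (suc a)
      N = #OP m (suc a) (firstPlain≡ k)
      overlined : ∀ c y → #OP-with-first m a (firstPlain≡ k) true c y ≡ 0# y
      overlined zero y = #OP-constant m (suc a) _ false (λ w → refl) y
      overlined (suc c) y = #OP-constant m (suc a) _ false (λ w → ∧-zeroʳ (suc c ≡ᵇ k)) y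
      plain : ∀ c y → #OP-with-first m a (firstPlain≡ k) false c y ≡ (at 0 N c ⊕ at k pb c) y
      plain zero y = sym (+-identityʳ (N y))
      plain (suc c) y = #OP-constant m (suc a) _ (c ≡ᵇ k') (λ w → ∧-identityʳ (c ≡ᵇ k')) y

  #OP-firstPlain≡⁺ : ∀ m a' k' x → x ≤ B →
    #OP (suc m) (suc a') (firstPlain≡⁺ (suc k')) x ≡
      shift (suc a') (#OP m (suc (suc a')) (firstPlain≡ (suc k')) ⊕ shift (suc a' * suc k') (pbar m (suc (suc a')))) x
      + (#OP m (suc (suc a')) (firstPlain≡ (suc k')) x + shift (suc a' * suc k') (pbar m (suc (suc a'))) x)
  #OP-firstPlain≡⁺ m a' k' x x≤B = begin
    #OP (suc m) a (firstPlain≡⁺ k) x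
      ≡⟨ #OP-by-first m a (firstPlain≡⁺ k) ψ ψ (by-first true) (by-first false) x ⟩
    shift a (Σq B a ψ) x + Σq B a ψ x
      ≡⟨ cong₂ _+_ (shift-Σq-cong a' ψ (N ⊕ shift (a * k) pb) x Σq-ψ x≤B) (Σq-ψ x x≤B) ⟩
    shift a (N ⊕ shift (a * k) pb) x + (N x + shift (a * k) pb x) ∎
    where
      a = suc a'
      k = suc k'
      pb = pbar m (suc a)
      N = #OP m (suc a) (firstPlain≡ k)
      ψ : ℕ → Series
      ψ c = at 0 N c ⊕ at k pb c
      Σq-ψ : ∀ z → z ≤ B → Σq B a ψ z ≡ N z + shift (a * k) pb z
      Σq-ψ z z≤B = trans (Σq-⊕ B a (at 0 N) (at k pb) z) (cong₂ _+_ (Σq-at0 B a' N z z≤B) (Σq-at k B a' pb z z≤B))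
      by-first : ∀ o c y → #OP-with-first m a (firstPlain≡⁺ k) o c y ≡ ψ c y
      by-first o zero y = sym (+-identityʳ (N y))
      by-first o (suc c) y = #OP-constant m (suc a) _ (c ≡ᵇ k') (λ w → refl) y

  #OP-hasOdds : ∀ m a' j x → x ≤ B →
    #OP (suc m) (suc a') (hasOdds (suc j)) x ≡ shift (suc a') (Ω (suc a') (#OP m (suc (suc a')) (hasOdds′ j))) x
  #OP-hasOdds m a' j x x≤B = begin
    #OP (suc m) a (hasOdds (suc j)) x
      ≡⟨ #OP-by-first m a (hasOdds (suc j)) (from 1 h) (from 1 h) (by-first true) (by-first false) x ⟩
    shift a (Σq B a (from 1 h)) x + Σq B a (from 1 h) x
      ≡⟨ cong₂ _+_ (shift-Σq-cong a' (from 1 h) (shift (a * 1) (Γ a h)) x (Σq-from 1 B a' h) x≤B)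
                   (Σq-from 1 B a' h x x≤B) ⟩
    shift a (shift (a * 1) (Γ a h)) x + shift (a * 1) (Γ a h) x
      ≡⟨ cong (λ e → shift a (shift e (Γ a h)) x + shift e (Γ a h) x) (*-identityʳ a) ⟩
    shift a (shift a (Γ a h)) x + shift a (Γ a h) x
      ≡⟨ +-comm (shift a (shift a (Γ a h)) x) (shift a (Γ a h) x) ⟩
    shift a (Γ a h) x + shift a (shift a (Γ a h)) x
      ≡⟨ shift-⊕ a (Γ a h) (shift a (Γ a h)) x ⟨
    shift a (Ω a h) x ∎
    where
      a = suc a'
      h = #OP m (suc a) (hasOdds′ j)
      by-first : ∀ o c y → #OP-with-first m a (hasOdds (suc j)) o c y ≡ from 1 h c y
      by-first o zero y = #OP-constant m (suc a) _ false (λ w → refl) y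
      by-first o (suc c) y = refl

  shift-pbar-unfold≈ : ∀ d m a' → shift d (pbar (suc m) (suc a')) ≈[ suc B ] Ω (suc a') (shift d (pbar m (suc (suc a'))))
  shift-pbar-unfold≈ d m a' x x<1+B =
    trans (shift-cong≈ d (suc B) _ _ (pbar-unfold≈ m a') x x<1+B) (sym (Ω-shift a' d (pbar m (suc (suc a'))) x))

  shift-pbar-empty : ∀ d a' → suc a' ≤ d → shift d (pbar 0 (suc a')) ≈[ suc a' ] 0#
  shift-pbar-empty d a' a≤d x x< = shift-< d (pbar 0 (suc a')) x (<-≤-trans x< a≤d)

  -- With only the sizes a, …, a + m - 1 available, the generating-function identities hold in
  -- degrees below a + m; the proofs go by induction on m, adding the size a in front.
  minMult≥-twice : ∀ t' m a' → suc a' + m ≤ suc B →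
    (λ x → shift (suc a' * suc t') (Γ (suc t') (pbar m (suc a'))) x
         + shift (suc a' * suc t') (Γ (suc t') (pbar m (suc a'))) x)
      ≈[ suc a' + m ]
    (λ x → #OP m (suc a') (minMult≥ (suc t')) x + Ω (suc t') (#OP m (suc a') (minMult≥ (suc (suc t')))) x)
  minMult≥-twice t' zero a' fits x x< = begin
    L + L   ≡⟨ cong (λ z → z + z) (shift-beyond a' t' (Γ (suc t') (pbar zero (suc a'))) x x<) ⟩
    0       ≡⟨ cong₂ _+_ (#OP-empty (suc a') (minMult≥ (suc t')) refl x)
                         (Ω-vanishing t' (suc a' + 0) _
                            (λ y _ → #OP-empty (suc a') (minMult≥ (suc (suc t'))) refl y) x x<) ⟨
    #OP 0 (suc a') (minMult≥ (suc t')) x + Ω (suc t') (#OP 0 (suc a') (minMult≥ (suc (suc t')))) x ∎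
    where L = shift (suc a' * suc t') (Γ (suc t') (pbar zero (suc a'))) x
  minMult≥-twice t' (suc m) a' fits x x< = begin
    L + L
      ≡⟨ cong (λ z → z + z)
           (trans (shift-cong≈ (a * t) (suc B) _ _ (Γ-cong≈ t' (suc B) _ _ (pbar-unfold≈ m a')) x x<1+B)
                                    (shift-Γ-Ω-split t' a' pb x)) ⟩
    (P + Y + Q) + (P + Y + Q)
      ≡⟨ regroup P Y Q ⟩
    (P + P) + ((Y + Y) + (Q + Q))
      ≡⟨ cong (_+ ((Y + Y) + (Q + Q))) (minMult≥-twice t' m (suc a') (step-fits a m fits) x (step-range a m x<)) ⟩
    (H₀ x + Ω t H x) + ((Y + Y) + (Q + Q))
      ≡⟨ interchange (H₀ x) (Ω t H x) (Y + Y) (Q + Q) ⟩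
    (H₀ x + (Y + Y)) + (Ω t H x + (Q + Q))
      ≡⟨ cong₂ _+_ (#OP-minMult≥ m a' t' x x≤B) Ω-step ⟨
    #OP (suc m) a (minMult≥ t) x + Ω t (#OP (suc m) a (minMult≥ (suc t))) x ∎
    where
      a = suc a'
      t = suc t'
      pb = pbar m (suc a)
      x<1+B = <-≤-trans x< fits
      x≤B = ≤-pred x<1+B
      L = shift (a * t) (Γ t (pbar (suc m) a)) x
      H₀ = #OP m (suc a) (minMult≥ t)
      H = #OP m (suc a) (minMult≥ (suc t))
      Z = shift (a * suc t) (Γ a pb)
      P = shift (suc a * t) (Γ t pb) x
      Y = shift (a * t) (Γ a pb) x
      Q = Ω t Z x
      Ω-step : Ω t (#OP (suc m) a (minMult≥ (suc t))) x ≡ Ω t H x + (Q + Q)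
      Ω-step = begin
        Ω t (#OP (suc m) a (minMult≥ (suc t))) x
          ≡⟨ Ω-cong≈ t' (suc B) _ _ (λ y y<1+B → #OP-minMult≥ m a' (suc t') y (≤-pred y<1+B)) x x<1+B ⟩
        Ω t (H ⊕ (Z ⊕ Z)) x
          ≡⟨ trans (Ω-⊕ t' H (Z ⊕ Z) x) (cong (Ω t H x +_) (Ω-⊕ t' Z Z x)) ⟩
        Ω t H x + (Q + Q) ∎
      regroup : ∀ p y q → (p + y + q) + (p + y + q) ≡ (p + p) + ((y + y) + (q + q))
      regroup = solve-∀

  firstPlain≡-Γ : ∀ k' m a' → suc a' + m ≤ suc B →
    Γ (suc k') (shift (suc a' * suc k') (pbar m (suc a')))
      ≈[ suc a' + m ]
    (λ x → Γ (suc k') (#OP m (suc a') (minMult≥ (suc (suc k')))) x + #OP m (suc a') (firstPlain≡ (suc k')) x)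
  firstPlain≡-Γ k' zero a' fits x x< = begin
    Γ (suc k') (shift (suc a' * suc k') (pbar zero (suc a'))) x
      ≡⟨ Γ-vanishing k' (suc a' + 0) _ (λ y y< → shift-beyond a' k' (pbar zero (suc a')) y y<) x x< ⟩
    0
      ≡⟨ cong₂ _+_ (Γ-vanishing k' (suc a' + 0) _ (λ y _ → #OP-empty (suc a') (minMult≥ (suc (suc k'))) refl y) x x<)
                   (#OP-empty (suc a') (firstPlain≡ (suc k')) refl x) ⟨
    Γ (suc k') (#OP 0 (suc a') (minMult≥ (suc (suc k')))) x + #OP 0 (suc a') (firstPlain≡ (suc k')) x ∎
  firstPlain≡-Γ k' (suc m) a' fits x x< = begin
    Γ k (shift (a * k) (pbar (suc m) a)) x
      ≡⟨ Γ-cong≈ k' (suc B) _ _ (shift-cong≈ (a * k) (suc B) _ _ (pbar-unfold≈ m a')) x x<1+B ⟩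
    Γ k (shift (a * k) (Ω a pb)) x
      ≡⟨ Γ-shift-Ω-split k' a' pb x ⟩
    Γ k (shift (suc a * k) pb) x + (G + G) + s
      ≡⟨ cong (λ z → z + (G + G) + s) (firstPlain≡-Γ k' m (suc a') (step-fits a m fits) x (step-range a m x<)) ⟩
    (Γ k H x + N x) + (G + G) + s
      ≡⟨ regroup (Γ k H x) (N x) G s ⟩
    (Γ k H x + (G + G)) + (N x + s)
      ≡⟨ cong₂ _+_ Γ-step (#OP-firstPlain≡ m a' k' x x≤B) ⟨
    Γ k (#OP (suc m) a (minMult≥ (suc k))) x + #OP (suc m) a (firstPlain≡ k) x ∎
    where
      a = suc a'
      k = suc k'
      pb = pbar m (suc a)
      x<1+B = <-≤-trans x< fits
      x≤B = ≤-pred x<1+B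
      H = #OP m (suc a) (minMult≥ (suc k))
      N = #OP m (suc a) (firstPlain≡ k)
      Z = shift (a * suc k) (Γ a pb)
      G = Γ k Z x
      s = shift (a * k) pb x
      Γ-step : Γ k (#OP (suc m) a (minMult≥ (suc k))) x ≡ Γ k H x + (G + G)
      Γ-step = begin
        Γ k (#OP (suc m) a (minMult≥ (suc k))) x
          ≡⟨ Γ-cong≈ k' (suc B) _ _ (λ y y<1+B → #OP-minMult≥ m a' k y (≤-pred y<1+B)) x x<1+B ⟩
        Γ k (H ⊕ (Z ⊕ Z)) x
          ≡⟨ trans (Γ-⊕ k' H (Z ⊕ Z) x) (cong (Γ k H x +_) (Γ-⊕ k' Z Z x)) ⟩
        Γ k H x + (G + G) ∎
      regroup : ∀ h n g s → (h + n) + (g + g) + s ≡ (h + (g + g)) + (n + s)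
      regroup = solve-∀

  minMult≥-firstPlain≡⁺ : ∀ k' m → suc k' + m ≤ suc B →
    shift (suc k' * suc k') (pbar m (suc k'))
      ≈[ suc k' + m ]
    (#OP m (suc k') (skip 1 (minMult≥ (suc (suc k')))) ⊕ #OP m (suc k') (firstPlain≡⁺ (suc k')))
  minMult≥-firstPlain≡⁺ k' zero fits x x< = begin
    shift (suc k' * suc k') (pbar zero (suc k')) x
      ≡⟨ shift-beyond k' k' (pbar zero (suc k')) x x< ⟩
    0
      ≡⟨ cong₂ _+_ (#OP-empty (suc k') (skip 1 (minMult≥ (suc (suc k')))) refl x)
                   (#OP-empty (suc k') (firstPlain≡⁺ (suc k')) refl x) ⟨
    #OP 0 (suc k') (skip 1 (minMult≥ (suc (suc k')))) x + #OP 0 (suc k') (firstPlain≡⁺ (suc k')) x ∎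
  minMult≥-firstPlain≡⁺ k' (suc m) fits x x< = begin
    shift (k * k) (pbar (suc m) k) x
      ≡⟨ shift-cong≈ (k * k) (suc B) _ _ (pbar-unfold≈ m k') x x<1+B ⟩
    shift (k * k) (Ω k pb) x
      ≡⟨ shift-⊕ (k * k) (Γ k pb) (shift k (Γ k pb)) x ⟩
    shift (k * k) (Γ k pb) x + shift (k * k) (shift k (Γ k pb)) x
      ≡⟨ cong (shift (k * k) (Γ k pb) x +_) (shift-comm (k * k) k (Γ k pb) x) ⟩
    X x + shift k X x
      ≡⟨ cong₂ _+_ (X≈ x x<′)
                   (trans (shift-cong≈ k (suc k + m) _ _ X≈ x x<′) (shift-⊕ k (Γ k H) (N ⊕ s) x)) ⟩
    (Γ k H x + (N x + s x)) + (shift k (Γ k H) x + shift k (N ⊕ s) x)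
      ≡⟨ regroup (Γ k H x) (N x + s x) (shift k (Γ k H) x) (shift k (N ⊕ s) x) ⟩
    (Γ k H x + shift k (Γ k H) x) + (shift k (N ⊕ s) x + (N x + s x))
      ≡⟨ cong₂ _+_ (#OP-ignoring-first m k' _ (minMult≥ (suc k)) (λ _ _ → refl) x x≤B)
                   (#OP-firstPlain≡⁺ m k' k' x x≤B) ⟨
    #OP (suc m) k (skip 1 (minMult≥ (suc k))) x + #OP (suc m) k (firstPlain≡⁺ k) x ∎
    where
      k = suc k'
      pb = pbar m (suc k)
      x<1+B = <-≤-trans x< fits
      x≤B = ≤-pred x<1+B
      x<′ = step-range k m x<
      H = #OP m (suc k) (minMult≥ (suc k))
      N = #OP m (suc k) (firstPlain≡ k)
      s = shift (k * k) pb
      X = shift (k * k) (Γ k pb)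
      X≈ : X ≈[ suc k + m ] (Γ k H ⊕ (N ⊕ s))
      X≈ y y< = begin
        shift (k * k) (Γ k pb) y
          ≡⟨ trans (shift-cong (k * k) _ _ (Γ-unfold k' pb) y) (shift-⊕-shift (k * k) pb k (Γ k pb) y) ⟩
        s y + shift (k * k + k) (Γ k pb) y
          ≡⟨ cong (s y +_) (shift-exponent (Γ k pb) y (+-comm (k * k) k)) ⟩
        s y + shift (suc k * k) (Γ k pb) y
          ≡⟨ cong (s y +_) (trans (sym (Γ-shift k' (suc k * k) pb y))
                                  (firstPlain≡-Γ k' m k (step-fits k m fits) y y<)) ⟩
        s y + (Γ k H y + N y)
          ≡⟨ rotate (s y) (Γ k H y) (N y) ⟩
        Γ k H y + (N y + s y) ∎
        where
          rotate : ∀ s h n → s + (h + n) ≡ h + (n + s)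
          rotate = solve-∀
      regroup : ∀ a b c d → (a + b) + (c + d) ≡ (a + c) + (d + b)
      regroup = solve-∀

  minMult≥-consecutive : ∀ t' m → suc t' + m ≤ suc B →
    (λ x → shift (suc t' * suc t') (pbar m (suc t')) x + shift (suc t' * suc t') (pbar m (suc t')) x)
      ≈[ suc t' + m ]
    (#OP m (suc t') (minMult≥ (suc t')) ⊕ #OP m (suc t') (skip 1 (minMult≥ (suc (suc t')))))
  minMult≥-consecutive t' zero fits x x< = begin
    L + L   ≡⟨ cong (λ z → z + z) (shift-beyond t' t' (pbar zero (suc t')) x x<) ⟩
    0       ≡⟨ cong₂ _+_ (#OP-empty (suc t') (minMult≥ (suc t')) refl x)
                         (#OP-empty (suc t') (skip 1 (minMult≥ (suc (suc t')))) refl x) ⟨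
    #OP 0 (suc t') (minMult≥ (suc t')) x + #OP 0 (suc t') (skip 1 (minMult≥ (suc (suc t')))) x ∎
    where L = shift (suc t' * suc t') (pbar zero (suc t')) x
  minMult≥-consecutive t' (suc m) fits x x< = begin
    L + L
      ≡⟨ cong (λ z → z + z) L≡Y+P ⟩
    (Y + P) + (Y + P)
      ≡⟨ regroup Y P ⟩
    (P + P) + (Y + Y)
      ≡⟨ cong (_+ (Y + Y)) (minMult≥-twice t' m t (step-fits t m fits) x (step-range t m x<)) ⟩
    (H₀ x + Ω t H x) + (Y + Y)
      ≡⟨ regroup′ (H₀ x) (Ω t H x) (Y + Y) ⟩
    (H₀ x + (Y + Y)) + Ω t H x
      ≡⟨ cong₂ _+_ (#OP-minMult≥ m t' t' x x≤B)
                   (#OP-ignoring-first m t' _ (minMult≥ (suc t)) (λ _ _ → refl) x x≤B) ⟨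
    #OP (suc m) t (minMult≥ t) x + #OP (suc m) t (skip 1 (minMult≥ (suc t))) x ∎
    where
      t = suc t'
      pb = pbar m (suc t)
      x<1+B = <-≤-trans x< fits
      x≤B = ≤-pred x<1+B
      H₀ = #OP m (suc t) (minMult≥ t)
      H = #OP m (suc t) (minMult≥ (suc t))
      L = shift (t * t) (pbar (suc m) t) x
      Y = shift (t * t) (Γ t pb) x
      P = shift (suc t * t) (Γ t pb) x
      L≡Y+P : L ≡ Y + P
      L≡Y+P = begin
        L                                 ≡⟨ shift-cong≈ (t * t) (suc B) _ _ (pbar-unfold≈ m t') x x<1+B ⟩
        shift (t * t) (Ω t pb) x          ≡⟨ shift-⊕-shift (t * t) (Γ t pb) t (Γ t pb) x ⟩
        Y + shift (t * t + t) (Γ t pb) x  ≡⟨ cong (Y +_) (shift-exponent (Γ t pb) x (+-comm (t * t) t)) ⟩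
        Y + P                             ∎
      regroup : ∀ y p → (y + p) + (y + p) ≡ (p + p) + (y + y)
      regroup = solve-∀
      regroup′ : ∀ a b c → (a + b) + c ≡ (a + c) + b
      regroup′ = solve-∀

  lift-through-prefix : (F : ℕ → ℕ → Series) (P₁ P₂ : ∀ {m} → Mult m → Bool) (a₀ : ℕ) →
    (∀ m a' → F (suc m) (suc a') ≈[ suc B ] Ω (suc a') (F m (suc (suc a')))) →
    (∀ a' → suc a' ≤ a₀ → F 0 (suc a') ≈[ suc a' ] 0#) →
    (∀ m → a₀ + m ≤ suc B → F m a₀ ≈[ a₀ + m ] (#OP m a₀ P₁ ⊕ #OP m a₀ P₂)) →
    ∀ p m a' → suc a' + p ≡ a₀ → suc a' + m ≤ suc B →
    F m (suc a') ≈[ suc a' + m ] (#OP m (suc a') (skip p P₁) ⊕ #OP m (suc a') (skip p P₂))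
  lift-through-prefix F P₁ P₂ a₀ F-unfold F-empty F-a₀ zero m a' a'+0≡a₀ fits
    with trans (sym (+-identityʳ (suc a'))) a'+0≡a₀
  ... | refl = F-a₀ m fits
  lift-through-prefix F P₁ P₂ a₀ F-unfold F-empty F-a₀ (suc p) zero a' a'+p≡a₀ fits x x< = begin
    F 0 (suc a') x
      ≡⟨ F-empty a' (subst (suc a' ≤_) a'+p≡a₀ (m≤m+n (suc a') (suc p)))
                 x (subst (x <_) (+-identityʳ (suc a')) x<) ⟩
    0
      ≡⟨ cong₂ _+_ (#OP-empty (suc a') (skip (suc p) P₁) refl x) (#OP-empty (suc a') (skip (suc p) P₂) refl x) ⟨
    #OP 0 (suc a') (skip (suc p) P₁) x + #OP 0 (suc a') (skip (suc p) P₂) x ∎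
  lift-through-prefix F P₁ P₂ a₀ F-unfold F-empty F-a₀ (suc p) (suc m) a' a'+p≡a₀ fits x x< = begin
    F (suc m) a x
      ≡⟨ F-unfold m a' x x<1+B ⟩
    Ω a (F m (suc a)) x
      ≡⟨ Ω-cong≈ a' (suc a + m) _ _ (lift-through-prefix F P₁ P₂ a₀ F-unfold F-empty F-a₀ p m a
            (trans (sym (+-suc a p)) a'+p≡a₀) (step-fits a m fits)) x (step-range a m x<) ⟩
    Ω a (#OP m (suc a) (skip p P₁) ⊕ #OP m (suc a) (skip p P₂)) x
      ≡⟨ Ω-⊕ a' (#OP m (suc a) (skip p P₁)) (#OP m (suc a) (skip p P₂)) x ⟩
    Ω a (#OP m (suc a) (skip p P₁)) x + Ω a (#OP m (suc a) (skip p P₂)) x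
      ≡⟨ cong₂ _+_ (#OP-ignoring-first m a' _ (skip p P₁) (λ _ _ → refl) x x≤B)
                   (#OP-ignoring-first m a' _ (skip p P₂) (λ _ _ → refl) x x≤B) ⟨
    #OP (suc m) a (skip (suc p) P₁) x + #OP (suc m) a (skip (suc p) P₂) x ∎
    where
      a = suc a'
      x<1+B = <-≤-trans x< fits
      x≤B = ≤-pred x<1+B

  #OP-hasOdds≈ : ∀ j m a' → suc a' + m ≤ suc B →
    #OP m (suc a') (hasOdds j) ≈[ suc a' + m ] shift (oddSum j (suc a')) (pbar m (suc a'))
  #OP-hasOdds′≈ : ∀ j m a' → suc a' + m ≤ suc B →
    #OP m (suc a') (hasOdds′ j) ≈[ suc a' + m ] shift (oddSum j (suc (suc a'))) (pbar m (suc a'))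

  #OP-hasOdds≈ zero m a' fits x x< = refl
  #OP-hasOdds≈ (suc j) zero a' fits x x< = begin
    #OP 0 (suc a') (hasOdds (suc j)) x                    ≡⟨ #OP-empty (suc a') (hasOdds (suc j)) refl x ⟩
    0                                                     ≡⟨ shift-< _ (pbar zero (suc a')) x x<oddSum ⟨
    shift (oddSum (suc j) (suc a')) (pbar 0 (suc a')) x   ∎
    where x<oddSum = <-≤-trans (subst (x <_) (+-identityʳ (suc a')) x<) (m≤m+n (suc a') _)
  #OP-hasOdds≈ (suc j) (suc m) a' fits x x< = begin
    #OP (suc m) a (hasOdds (suc j)) x
      ≡⟨ #OP-hasOdds m a' j x (≤-pred x<1+B) ⟩
    shift a (Ω a (#OP m (suc a) (hasOdds′ j))) x
      ≡⟨ shift-cong≈ a (suc a + m) _ _ (Ω-cong≈ a' (suc a + m) _ _ (#OP-hasOdds′≈ j m (suc a') (step-fits a m fits)))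
                     x (step-range a m x<) ⟩
    shift a (Ω a (shift E pb)) x
      ≡⟨ trans (shift-cong a _ _ (Ω-shift a' E pb) x) (shift-shift a E (Ω a pb) x) ⟩
    shift (a + E) (Ω a pb) x
      ≡⟨ shift-cong≈ (a + E) (suc B) _ _ (pbar-unfold≈ m a') x x<1+B ⟨
    shift (a + E) (pbar (suc m) a) x ∎
    where
      a = suc a'
      pb = pbar m (suc a)
      E = oddSum j (suc (suc a))
      x<1+B = <-≤-trans x< fits

  #OP-hasOdds′≈ zero m a' fits x x< = refl
  #OP-hasOdds′≈ (suc j) zero a' fits x x< = begin
    #OP 0 (suc a') (hasOdds′ (suc j)) x                         ≡⟨ #OP-empty (suc a') (hasOdds′ (suc j)) refl x ⟩
    0                                                           ≡⟨ shift-< _ (pbar zero (suc a')) x x<oddSum ⟨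
    shift (oddSum (suc j) (suc (suc a'))) (pbar 0 (suc a')) x   ∎
    where
      x<oddSum = <-≤-trans (subst (x <_) (+-identityʳ (suc a')) x<) (≤-trans (n≤1+n (suc a')) (m≤m+n (suc (suc a')) _))
  #OP-hasOdds′≈ (suc j) (suc m) a' fits x x< = begin
    #OP (suc m) a (hasOdds′ (suc j)) x
      ≡⟨ #OP-ignoring-first m a' _ (hasOdds (suc j)) (λ _ _ → refl) x (≤-pred x<1+B) ⟩
    Ω a (#OP m (suc a) (hasOdds (suc j))) x
      ≡⟨ Ω-cong≈ a' (suc a + m) _ _ (#OP-hasOdds≈ (suc j) m (suc a') (step-fits a m fits)) x (step-range a m x<) ⟩
    Ω a (shift E pb) x
      ≡⟨ Ω-shift a' E pb x ⟩
    shift E (Ω a pb) x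
      ≡⟨ shift-cong≈ E (suc B) _ _ (pbar-unfold≈ m a') x x<1+B ⟨
    shift E (pbar (suc m) a) x ∎
    where
      a = suc a'
      pb = pbar m (suc a)
      E = oddSum (suc j) (suc a)
      x<1+B = <-≤-trans x< fits

module AtWeight (n : ℕ) where
  open Bounded n

  O : ℕ → ℕ
  O j = op21 n j

  A : ℕ → ℕ
  A j = #OP n 1 (hasOdds j) n

  M : ℕ → ℕ
  M k = Mbar k n

  N : ℕ → ℕ
  N k = Nbar k n

  numOP≡#OP : ∀ P → numOP n P ≡ #OP n 1 P n
  numOP≡#OP P = count-filter P (λ v → weight v ≡ᵇ n) (allMult n n)

  op21-consecutive : ∀ j → O j + O (suc j) ≡ A j
  op21-consecutive j = trans (cong₂ _+_ (numOP≡#OP (op21Pred j)) (numOP≡#OP (op21Pred (suc j))))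
    (count-add _ _ _ (λ w → bit-∧ (weightFrom 1 w ≡ᵇ n) (op21Pred-consecutive j w)) (allMult n n))
    where
      bit-∧ : ∀ {p q r} b → bit p + bit q ≡ bit r → bit (b ∧ p) + bit (b ∧ q) ≡ bit (b ∧ r)
      bit-∧ true e = e
      bit-∧ false e = refl

  A≡shifted-pbar : ∀ j → A j ≡ shift (j * j) (pbar n 1) n
  A≡shifted-pbar j = trans (#OP-hasOdds≈ j n 0 ≤-refl n ≤-refl) (shift-exponent (pbar n 1) n (oddSum-squares j))

  Mbar≡#OP : ∀ k → M k ≡ #OP n 1 (skip k (minMult≥ (suc k))) n
  Mbar≡#OP k = trans (numOP≡#OP (Mpred k)) (#OP-cong n 1 _ _ (Mpred≡skip-minMult≥ k) n)

  Nbar≡#OP : ∀ k' → N (suc k') ≡ #OP n 1 (skip k' (firstPlain≡⁺ (suc k'))) n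
  Nbar≡#OP k' = trans (numOP≡#OP (Npred (suc k'))) (#OP-cong n 1 _ _ (Npred≡skip-firstPlain≡⁺ k') n)

  Mbar-consecutive : ∀ k' → A (suc (suc k')) + A (suc (suc k')) ≡ M (suc k') + M (suc (suc k'))
  Mbar-consecutive k' = begin
    A (suc k) + A (suc k)
      ≡⟨ cong (λ z → z + z) (A≡shifted-pbar (suc k)) ⟩
    F n 1 n
      ≡⟨ lift-through-prefix F (minMult≥ (suc k)) (skip 1 (minMult≥ (suc (suc k)))) (suc k) F-unfold F-empty
           (minMult≥-consecutive k) k n 0 refl ≤-refl n ≤-refl ⟩
    #OP n 1 (skip k (minMult≥ (suc k))) n + #OP n 1 (skip k (skip 1 (minMult≥ (suc (suc k))))) n
      ≡⟨ cong₂ _+_ (Mbar≡#OP k)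
                   (trans (Mbar≡#OP (suc k)) (#OP-cong n 1 _ _ (skip-suc k (minMult≥ (suc (suc k)))) n)) ⟨
    M k + M (suc k) ∎
    where
      k = suc k'
      d = suc k * suc k
      F : ℕ → ℕ → Series
      F m a = shift d (pbar m a) ⊕ shift d (pbar m a)
      F-unfold : ∀ m a' → F (suc m) (suc a') ≈[ suc n ] Ω (suc a') (F m (suc (suc a')))
      F-unfold m a' x x< =
        trans (cong₂ _+_ (shift-pbar-unfold≈ d m a' x x<) (shift-pbar-unfold≈ d m a' x x<)) (sym (Ω-⊕ a' _ _ x))
      F-empty : ∀ a' → suc a' ≤ suc k → F 0 (suc a') ≈[ suc a' ] 0#
      F-empty a' a≤k x x< = cong (λ z → z + z) (shift-pbar-empty d a' (≤-trans a≤k (m≤m*n (suc k) (suc k))) x x<)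

  Mbar+Nbar : ∀ k' → A (suc k') ≡ M (suc k') + N (suc k')
  Mbar+Nbar k' = begin
    A k
      ≡⟨ A≡shifted-pbar k ⟩
    shift d (pbar n 1) n
      ≡⟨ lift-through-prefix (λ m a → shift d (pbar m a)) (skip 1 (minMult≥ (suc k))) (firstPlain≡⁺ k) k
           (shift-pbar-unfold≈ d) F-empty (minMult≥-firstPlain≡⁺ k') k' n 0 refl ≤-refl n ≤-refl ⟩
    #OP n 1 (skip k' (skip 1 (minMult≥ (suc k)))) n + #OP n 1 (skip k' (firstPlain≡⁺ k)) n
      ≡⟨ cong₂ _+_ (trans (Mbar≡#OP k) (#OP-cong n 1 _ _ (skip-suc k' (minMult≥ (suc k))) n)) (Nbar≡#OP k') ⟨
    M k + N k ∎
    where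
      k = suc k'
      d = k * k
      F-empty : ∀ a' → suc a' ≤ k → shift d (pbar 0 (suc a')) ≈[ suc a' ] 0#
      F-empty a' a≤k = shift-pbar-empty d a' (≤-trans a≤k (m≤m*n k k))

  op21-vanishing : ∀ k → n ≤ k → O (suc k) ≡ 0
  op21-vanishing k n≤k = m+n≡0⇒m≡0 (O (suc k)) (begin
    O (suc k) + O (suc (suc k))        ≡⟨ op21-consecutive (suc k) ⟩
    A (suc k)                          ≡⟨ A≡shifted-pbar (suc k) ⟩
    shift (suc k * suc k) (pbar n 1) n ≡⟨ shift-< _ (pbar n 1) n (<-≤-trans (s≤s n≤k) (m≤m*n (suc k) (suc k))) ⟩
    0                                  ∎)

  Mbar-vanishing : ∀ k → n ≤ k → M k ≡ 0
  Mbar-vanishing k n≤k =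
    trans (Mbar≡#OP k) (#OP-constant n 1 _ false (λ w → skip-beyond k (minMult≥ (suc k)) w refl n≤k) n)

  twice-op21≡Mbar-from : ∀ d k → n ≤ suc k + d → 2 * O (suc (suc k)) ≡ M (suc k)
  twice-op21≡Mbar-from d k n≤ with n ≤? suc k
  ... | yes n≤1+k rewrite op21-vanishing (suc k) n≤1+k | Mbar-vanishing (suc k) n≤1+k = refl
  twice-op21≡Mbar-from zero k n≤ | no n≰1+k = ⊥-elim (n≰1+k (subst (n ≤_) (+-identityʳ (suc k)) n≤))
  twice-op21≡Mbar-from (suc d) k n≤ | no _ = +-cancelʳ-≡ (M (suc (suc k))) (2 * O (suc (suc k))) (M (suc k)) (begin
    2 * O (suc (suc k)) + M (suc (suc k))
      ≡⟨ cong (2 * O (suc (suc k)) +_) (twice-op21≡Mbar-from d (suc k) (subst (n ≤_) (+-suc (suc k) d) n≤)) ⟨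
    2 * O (suc (suc k)) + 2 * O (suc (suc (suc k)))
      ≡⟨ *-distribˡ-+ 2 (O (suc (suc k))) (O (suc (suc (suc k)))) ⟨
    2 * (O (suc (suc k)) + O (suc (suc (suc k))))
      ≡⟨ cong (2 *_) (op21-consecutive (suc (suc k))) ⟩
    A (suc (suc k)) + (A (suc (suc k)) + 0)
      ≡⟨ cong (A (suc (suc k)) +_) (+-identityʳ (A (suc (suc k)))) ⟩
    A (suc (suc k)) + A (suc (suc k))
      ≡⟨ Mbar-consecutive k ⟩
    M (suc k) + M (suc (suc k)) ∎)

  twice-op21≡Mbar : ∀ k → 2 * O (suc (suc k)) ≡ M (suc k)
  twice-op21≡Mbar k = twice-op21≡Mbar-from n k (m≤n+m n (suc k))

  op21-difference : ∀ k' → O (suc k') ≡ O (suc (suc k')) + N (suc k')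
  op21-difference k' = +-cancelʳ-≡ (O (suc k)) (O k) (O (suc k) + N k) (begin
    O k + O (suc k)              ≡⟨ op21-consecutive k ⟩
    A k                          ≡⟨ Mbar+Nbar k' ⟩
    M k + N k                    ≡⟨ cong (_+ N k) (twice-op21≡Mbar k') ⟨
    2 * O (suc k) + N k          ≡⟨ 2a+b≡[a+b]+a (O (suc k)) (N k) ⟩
    (O (suc k) + N k) + O (suc k) ∎)
    where
      k = suc k'
      2a+b≡[a+b]+a : ∀ a b → 2 * a + b ≡ (a + b) + a
      2a+b≡[a+b]+a = solve-∀

corollary2p7 : (n k : ℕ) → 1 ≤ n → 1 ≤ k →
    (2 * op21 n (suc k) ≡ Mbar k n) × (op21 n k ≡ op21 n (suc k) + Nbar k n)
corollary2p7 n (suc k') _ _ = AtWeight.twice-op21≡Mbar n k' , AtWeight.op21-difference n k'
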